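{- Let $p=p(n)\in(0,1)$ and let $K_{n,p}=f_1(C_{n,p})$ be the number of edges of the cosmological polytope of the Erdős–Rényi random graph $G_{n,p}$, viewed as a function of the arc variables. Then there is a constant $C>0$, not depending on $n$, $p$ or the arcs, such that for all $e,f\in\binom{[n]}{2}$, almost surely $|\operatorname{D}_f\operatorname{D}_eK_{n,p}|\le C\,p(1-p)$. In particular $\mathbb{E}[(\operatorname{D}_f\operatorname{D}_eK_{n,p})^4]\le C^4p^4(1-p)^4$.
   Context: For a finite simple graph $G=(V,E)$ (nodes $V$, arcs $E$), with standard basis $(\mathbf e_a)_{a\in V\cup E}$ of $\mathbb R^{V\cup E}$, the cosmological polytope is $C_G=\operatorname{conv}\{\mathbf e_i+\mathbf e_j-\mathbf e_f,\ \mathbf e_i-\mathbf e_j+\mathbf e_f,\ -\mathbf e_i+\mathbf e_j+\mathbf e_f : f=\{i,j\}\in E\}$; $f_1$ is the number of edges of a polytope. $G_{n,p}$ is encoded by independent random variables $(X_e)_{e\in\binom{[n]}{2}}$ with $\mathbb P(X_e=1)=p$, $\mathbb P(X_e=-1)=1-p$, arc $e$ being present iff $X_e=1$; $C_{n,p}=C_{G_{n,p}}$. For a functional $F$ of $(X_e)$, $F_e^{\pm}$ denotes $F$ with $X_e$ set to $\pm1$, the discrete gradient is $\operatorname{D}_eF=\sqrt{p(1-p)}(F_e^+-F_e^-)$, and $\operatorname{D}_f\operatorname{D}_eF$ is $\operatorname{D}_f$ applied to $\operatorname{D}_eF$. -}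

module Defs where

open import Data.Bool using (Bool; true; false; if_then_else_; _∧_)
open import Data.Nat using (ℕ)
open import Data.Fin using (Fin; _<_; _<?_)
open import Data.Fin.Properties using (_≟_)
open import Data.Product using (Σ; Σ-syntax; ∃; _×_; _,_)
open import Data.Sum using (_⊎_; inj₁; inj₂)
open import Data.List using (List; []; _∷_; _++_; map; foldr; filter; allFin; cartesianProduct; concatMap; length)
open import Data.List.Membership.Propositional using (_∈_)
open import Data.List.Relation.Unary.AllPairs using (AllPairs)
open import Data.List.Relation.Unary.All using (All)
open import Data.Rational using (ℚ; 0ℚ; 1ℚ; _+_; _*_; _-_; -_; _≤_)
open import Relation.Nullary using (¬_; ⌊_⌋)
open import Relation.Binary.PropositionalEquality using (_≡_)

module _ {I : Set} (idx : List I) where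

  Pt : Set
  Pt = I → ℚ

  _≈ₚ_ : Pt → Pt → Set
  u ≈ₚ v = ∀ i → u i ≡ v i

  dot : Pt → Pt → ℚ
  dot c x = foldr _+_ 0ℚ (map (λ i → c i * x i) idx)

  OnSegment : Pt → Pt → Pt → Set
  OnSegment u v w = Σ[ t ∈ ℚ ] (0ℚ ≤ t × t ≤ 1ℚ ×
                     (∀ i → w i ≡ t * u i + (1ℚ - t) * v i))

  -- conv{u,v} (u ≠ v, u,v ∈ S) is a face of conv(S): some linear functional c
  -- is maximised over S exactly at the points of S lying in [u,v].
  -- (Then u, v are automatically vertices and the face is an edge.)
  IsEdge : List Pt → Pt → Pt → Set
  IsEdge S u v =
    u ∈ S × v ∈ S × ¬ (u ≈ₚ v) ×
    Σ[ c ∈ Pt ] (dot c u ≡ dot c v ×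
      All (λ w → dot c w ≤ dot c u × (dot c w ≡ dot c u → OnSegment u v w)) S)

  SamePair : Pt × Pt → Pt × Pt → Set
  SamePair (u , v) (u' , v') = (u ≈ₚ u' × v ≈ₚ v') ⊎ (u ≈ₚ v' × v ≈ₚ u')

  EdgeCount : List Pt → ℕ → Set
  EdgeCount S k = Σ[ L ∈ List (Pt × Pt) ]
    (length L ≡ k ×
     All (λ { (u , v) → IsEdge S u v }) L ×
     AllPairs (λ p q → ¬ SamePair p q) L ×
     (∀ u v → IsEdge S u v → Σ[ q ∈ Pt × Pt ] (q ∈ L × SamePair (u , v) q)))

-- An arc {i,j} is encoded by (i , j) with i < j.  A configuration X
-- gives X i j = true iff the arc (i,j) (i < j) is present; values at
-- (i,j) with ¬ i < j are ignored.

Config : ℕ → Set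
Config n = Fin n → Fin n → Bool

set : ∀ {n} → Config n → Fin n → Fin n → Bool → Config n
set X i j b a c = if ⌊ a ≟ i ⌋ ∧ ⌊ c ≟ j ⌋ then b else X a c

-- coordinates: nodes ⊎ arcs (ℝ^{V∪E} embedded in ℝ^{V ∪ all pairs})
Coord : ℕ → Set
Coord n = Fin n ⊎ (Fin n × Fin n)

coords : ∀ n → List (Coord n)
coords n = map inj₁ (allFin n) ++ map inj₂ (cartesianProduct (allFin n) (allFin n))

vec : ∀ {n} → ℚ → ℚ → ℚ → Fin n → Fin n → Coord n → ℚ
vec α β γ i j (inj₁ k) =
  (if ⌊ k ≟ i ⌋ then α else 0ℚ) + (if ⌊ k ≟ j ⌋ then β else 0ℚ)
vec α β γ i j (inj₂ (k , l)) = if ⌊ k ≟ i ⌋ ∧ ⌊ l ≟ j ⌋ then γ else 0ℚ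

pairs : ∀ n → List (Fin n × Fin n)
pairs n = filter (λ { (i , j) → i <? j }) (cartesianProduct (allFin n) (allFin n))

arcs : ∀ {n} → Config n → List (Fin n × Fin n)
arcs {n} X = filter (λ { (i , j) → X i j Data.Bool.≟ true }) (pairs n)

cosmoPts : ∀ {n} → Config n → List (Coord n → ℚ)
cosmoPts X = concatMap
  (λ { (i , j) → vec 1ℚ 1ℚ (- 1ℚ) i j ∷ vec 1ℚ (- 1ℚ) 1ℚ i j ∷ vec (- 1ℚ) 1ℚ 1ℚ i j ∷ [] })
  (arcs X)

F1 : ∀ {n} → Config n → ℕ → Set
F1 {n} X k = EdgeCount (coords n) (cosmoPts X) k

{-# OPTIONS --safe #-}
-- f₁(C_G) depends only on the number m of arcs and the number of leaves (nodes of degree one) of G: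
-- f₁(C_G) = 9·C(m,2) + m + #leaves.  Two generators on different arcs always span an edge.  On one arc
-- f = {i,j}, e_i − e_j + e_f and −e_i + e_j + e_f always span an edge, while e_i + e_j − e_f spans an edge
-- with e_i − e_j + e_f (resp. −e_i + e_j + e_f) exactly when i (resp. j) is a leaf; otherwise a second arc
-- at i supplies two other generators with the same midpoint e_i.  In the second difference with respect
-- to two arcs e and f, the binomial term contributes exactly 9 and the leaf count changes only at the two
-- endpoints of e, by at most 2 at each, so the second difference is at most 13 in absolute value.
module Submission where

module Counting where

  open import Function using (_∘_)
  open import Function.Bundles using (Equivalence)
  open import Data.Bool using (Bool; true; false; _∧_)
  open import Data.Bool.Properties using (T-≡)
  open import Data.Fin using (Fin; zero; suc)
  open import Data.Fin.Properties using (injective⇒≤)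
  import Data.Fin.Properties as Fin
  open import Data.List using (List; []; _∷_; _++_; map; length; lookup; filter; filterᵇ)
  open import Data.List.Membership.Propositional using (_∈_)
  open import Data.List.Membership.Propositional.Properties
    using (∈-lookup; ∈-map⁺; ∈-map⁻; ∈-++⁺ˡ; ∈-++⁺ʳ; ∈-++⁻; ∈-filter⁺; ∈-filter⁻)
  open import Data.List.Relation.Unary.All as All using (All; []; _∷_)
  import Data.List.Relation.Unary.All.Properties as All
  open import Data.List.Relation.Unary.AllPairs using (AllPairs; []; _∷_)
  import Data.List.Relation.Unary.AllPairs.Properties as AllPairs
  open import Data.List.Relation.Unary.Any as Any using (Any; here; there)
  open import Data.List.Relation.Unary.Any.Properties using (lookup-index)
  open import Data.List.Relation.Unary.Unique.Propositional using (Unique)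
  open import Data.Nat using (ℕ; zero; suc; _+_; _*_; _≤_; _<_; s≤s; z≤n)
  import Data.Nat.Properties as ℕ
  open import Data.Nat.Properties using (+-assoc; +-comm; ≤-trans; m≤n+m; <-irrefl; suc-injective; ≤-pred)
  open import Algebra.Properties.Semiring.Sum ℕ.+-*-semiring using (sum-syntax; sum-cong-≗; ∑-distrib-+)
  open import Data.Product using (Σ-syntax; _×_; _,_; proj₁; proj₂)
  open import Data.Sum using (_⊎_; inj₁; inj₂)
  open import Relation.Binary.Definitions using (DecidableEquality)
  open import Relation.Nullary using (¬_; contradiction; does; ⌊_⌋)
  open import Relation.Nullary.Decidable using (T?; dec-true; dec-false; isYes≗does; ⌊⌋-map′)
  open import Relation.Unary using (Decidable)
  open import Relation.Binary.PropositionalEquality using (_≡_; _≢_; refl; sym; trans; cong; cong₂; subst)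

  module _ {A : Set} (_≟_ : DecidableEquality A) where

    ⌊≟⌋-refl : ∀ x → ⌊ x ≟ x ⌋ ≡ true
    ⌊≟⌋-refl x = trans (isYes≗does (x ≟ x)) (dec-true (x ≟ x) refl)

    ⌊≟⌋-≢ : ∀ {x y} → x ≢ y → ⌊ x ≟ y ⌋ ≡ false
    ⌊≟⌋-≢ {x} {y} x≢y = trans (isYes≗does (x ≟ y)) (dec-false (x ≟ y) x≢y)

  module _ {A : Set} {R : A → A → Set} (R-sym : ∀ {x y} → R x y → R y x) where

    lookup-injective : ∀ {xs} → AllPairs (λ x y → ¬ R x y) xs →
                       ∀ {a b} → R (lookup xs a) (lookup xs b) → a ≡ b
    lookup-injective (_ ∷ _)  {zero}  {zero}  _ = refl
    lookup-injective (x≁ ∷ _) {zero}  {suc b} r = contradiction r (All.lookup x≁ (∈-lookup b))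
    lookup-injective (x≁ ∷ _) {suc a} {zero}  r = contradiction (R-sym r) (All.lookup x≁ (∈-lookup a))
    lookup-injective (_ ∷ u)  {suc a} {suc b} r = cong suc (lookup-injective u r)

    length-≤ : (∀ {x y z} → R x y → R y z → R x z) →
               ∀ {xs ys} → AllPairs (λ x y → ¬ R x y) xs → (∀ {x} → x ∈ xs → Any (R x) ys) →
               length xs ≤ length ys
    length-≤ R-trans {xs} {ys} u cover = injective⇒≤ index-injective
      where
      index : Fin (length xs) → Fin (length ys)
      index a = Any.index (cover (∈-lookup a))

      index-injective : ∀ {a b} → index a ≡ index b → a ≡ b
      index-injective {a} {b} eq = lookup-injective u (R-trans (lookup-index (cover (∈-lookup a)))
        (R-sym (subst (λ k → R (lookup xs b) (lookup ys k)) (sym eq) (lookup-index (cover (∈-lookup b))))))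

  Unordered : {A : Set} → (A → A → Set) → A × A → A × A → Set
  Unordered R (a , b) (c , d) = (R a c × R b d) ⊎ (R a d × R b c)

  module _ {A : Set} {R : A → A → Set} where

    Unordered-sym : (∀ {x y} → R x y → R y x) → ∀ {p q} → Unordered R p q → Unordered R q p
    Unordered-sym R-sym (inj₁ (ac , bd)) = inj₁ (R-sym ac , R-sym bd)
    Unordered-sym R-sym (inj₂ (ad , bc)) = inj₂ (R-sym bc , R-sym ad)

    Unordered-trans : (∀ {x y z} → R x y → R y z → R x z) →
                      ∀ {p q r} → Unordered R p q → Unordered R q r → Unordered R p r
    Unordered-trans R-trans (inj₁ (ac , bd)) (inj₁ (ce , df)) = inj₁ (R-trans ac ce , R-trans bd df)
    Unordered-trans R-trans (inj₁ (ac , bd)) (inj₂ (cf , de)) = inj₂ (R-trans ac cf , R-trans bd de)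
    Unordered-trans R-trans (inj₂ (ad , bc)) (inj₁ (ce , df)) = inj₂ (R-trans ad df , R-trans bc ce)
    Unordered-trans R-trans (inj₂ (ad , bc)) (inj₂ (cf , de)) = inj₁ (R-trans ad de , R-trans bc cf)

  AllPairs-mapWith : ∀ {A : Set} {P : A → Set} {R S : A → A → Set} →
                     (∀ {x y} → P x → R x y → S x y) →
                     ∀ {xs} → All P xs → AllPairs R xs → AllPairs S xs
  AllPairs-mapWith f []         []         = []
  AllPairs-mapWith f (px ∷ pxs) (rx ∷ rxs) = All.map (f px) rx ∷ AllPairs-mapWith f pxs rxs

  pairsOf : {A : Set} → List A → List (A × A)
  pairsOf []       = []
  pairsOf (x ∷ xs) = map (x ,_) xs ++ pairsOf xs

  module _ {A : Set} where

    ∈-pairsOf⁻ : ∀ xs {p : A × A} → p ∈ pairsOf xs → proj₁ p ∈ xs × proj₂ p ∈ xs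
    ∈-pairsOf⁻ (x ∷ xs) p∈ with ∈-++⁻ (map (x ,_) xs) p∈
    ... | inj₁ p∈x,xs with ∈-map⁻ (x ,_) p∈x,xs
    ...   | y , y∈ , refl = here refl , there y∈
    ∈-pairsOf⁻ (x ∷ xs) p∈ | inj₂ p∈xs with ∈-pairsOf⁻ xs p∈xs
    ...   | a∈ , b∈ = there a∈ , there b∈

    pairsOf-distinct : ∀ {xs} → Unique xs → {p : A × A} → p ∈ pairsOf xs → proj₁ p ≢ proj₂ p
    pairsOf-distinct {x ∷ xs} (x∉ ∷ u) p∈ with ∈-++⁻ (map (x ,_) xs) p∈
    ... | inj₁ p∈x,xs with ∈-map⁻ (x ,_) p∈x,xs
    ...   | y , y∈ , refl = All.lookup x∉ y∈
    pairsOf-distinct (_ ∷ u) _ | inj₂ p∈xs = pairsOf-distinct u p∈xs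

    ∈-pairsOf⁺ : ∀ xs {a b : A} → a ∈ xs → b ∈ xs → a ≢ b →
                 (a , b) ∈ pairsOf xs ⊎ (b , a) ∈ pairsOf xs
    ∈-pairsOf⁺ (x ∷ xs) (here refl) (here refl) a≢b = contradiction refl a≢b
    ∈-pairsOf⁺ (x ∷ xs) (here refl) (there b∈) _   = inj₁ (∈-++⁺ˡ (∈-map⁺ (x ,_) b∈))
    ∈-pairsOf⁺ (x ∷ xs) (there a∈) (here refl) _   = inj₂ (∈-++⁺ˡ (∈-map⁺ (x ,_) a∈))
    ∈-pairsOf⁺ (x ∷ xs) (there a∈) (there b∈) a≢b with ∈-pairsOf⁺ xs a∈ b∈ a≢b
    ... | inj₁ ab∈ = inj₁ (∈-++⁺ʳ (map (x ,_) xs) ab∈)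
    ... | inj₂ ba∈ = inj₂ (∈-++⁺ʳ (map (x ,_) xs) ba∈)

    pairsOf-unique : ∀ {R : A → A → Set} {xs} → AllPairs (λ x y → ¬ R x y) xs →
                     AllPairs (λ p q → ¬ Unordered R p q) (pairsOf xs)
    pairsOf-unique {R} {[]} [] = []
    pairsOf-unique {R} {x ∷ xs} (x≁ ∷ u) =
      AllPairs.++⁺ (AllPairs.map⁺ (fan x≁ u)) (pairsOf-unique u) (All.map⁺ (All.tabulate cross))
      where
      fan : ∀ {ys} → All (λ y → ¬ R x y) ys → AllPairs (λ y z → ¬ R y z) ys →
            AllPairs (λ y z → ¬ Unordered R (x , y) (x , z)) ys
      fan []            []          = []
      fan {y ∷ _} (_ ∷ x≁ys) (y≁ys ∷ u) = All.zipWith step (x≁ys , y≁ys) ∷ fan x≁ys u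
        where
        step : ∀ {z} → ¬ R x z × ¬ R y z → ¬ Unordered R (x , y) (x , z)
        step (_ , y≁z) (inj₁ (_ , yz)) = y≁z yz
        step (x≁z , _) (inj₂ (xz , _)) = x≁z xz

      cross : ∀ {y} → y ∈ xs → All (λ q → ¬ Unordered R (x , y) q) (pairsOf xs)
      cross _ = All.tabulate λ q∈ → λ
        { (inj₁ (xc , _)) → All.lookup x≁ (proj₁ (∈-pairsOf⁻ xs q∈)) xc
        ; (inj₂ (xd , _)) → All.lookup x≁ (proj₂ (∈-pairsOf⁻ xs q∈)) xd }

  𝟙 : Bool → ℕ
  𝟙 true  = 1
  𝟙 false = 0

  count : {A : Set} → (A → Bool) → List A → ℕ
  count p []       = 0
  count p (x ∷ xs) = 𝟙 (p x) + count p xs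

  module _ {A : Set} where

    count-cong : ∀ {p q : A → Bool} xs → (∀ {x} → x ∈ xs → p x ≡ q x) → count p xs ≡ count q xs
    count-cong []       _   = refl
    count-cong (x ∷ xs) p≗q = cong₂ _+_ (cong 𝟙 (p≗q (here refl))) (count-cong xs (p≗q ∘ there))

    length-filterᵇ : ∀ (p : A → Bool) xs → length (filterᵇ p xs) ≡ count p xs
    length-filterᵇ p []       = refl
    length-filterᵇ p (x ∷ xs) with p x
    ... | true  = cong suc (length-filterᵇ p xs)
    ... | false = length-filterᵇ p xs

    count-++ : ∀ (p : A → Bool) xs ys → count p (xs ++ ys) ≡ count p xs + count p ys
    count-++ p []       ys = refl
    count-++ p (x ∷ xs) ys = trans (cong (𝟙 (p x) +_) (count-++ p xs ys)) (sym (+-assoc (𝟙 (p x)) _ _))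

    count-map : ∀ {B : Set} (p : B → Bool) (f : A → B) xs → count p (map f xs) ≡ count (p ∘ f) xs
    count-map p f []       = refl
    count-map p f (x ∷ xs) = cong (𝟙 (p (f x)) +_) (count-map p f xs)

    count-all : ∀ (p : A → Bool) xs → (∀ {x} → x ∈ xs → p x ≡ true) → count p xs ≡ length xs
    count-all p []       _   = refl
    count-all p (x ∷ xs) all rewrite all (here refl) = cong suc (count-all p xs (all ∘ there))

    count-toggle : ∀ {p q : A → Bool} {xs e} → Unique xs → e ∈ xs →
                   (∀ {x} → x ≢ e → p x ≡ q x) → q e ≡ false →
                   count p xs ≡ count q xs + 𝟙 (p e)
    count-toggle {p} {q} {e ∷ xs} (e∉ ∷ _) (here refl) p≗q qe rewrite qe =
      trans (cong (𝟙 (p e) +_) (count-cong xs (λ x∈ → p≗q (All.lookup e∉ x∈ ∘ sym))))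
            (+-comm (𝟙 (p e)) (count q xs))
    count-toggle {p} {q} {x ∷ xs} (x∉ ∷ u) (there e∈) p≗q qe =
      trans (cong₂ _+_ (cong 𝟙 (p≗q (All.lookup x∉ e∈))) (count-toggle u e∈ p≗q qe))
            (sym (+-assoc (𝟙 (q x)) _ _))

    count-filter : ∀ {P : A → Set} (P? : Decidable P) (w : A → Bool) xs →
                   count w (filter P? xs) ≡ count (λ x → does (P? x) ∧ w x) xs
    count-filter P? w []       = refl
    count-filter P? w (x ∷ xs) with does (P? x)
    ... | true  = cong (𝟙 (w x) +_) (count-filter P? w xs)
    ... | false = count-filter P? w xs

  module _ {A : Set} {p : A → Bool} where

    ∈⇒count-pos : ∀ {xs x} → x ∈ xs → p x ≡ true → 1 ≤ count p xs
    ∈⇒count-pos {x ∷ xs} (here refl) px rewrite px = s≤s z≤n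
    ∈⇒count-pos {y ∷ xs} (there x∈)  px = ≤-trans (∈⇒count-pos x∈ px) (m≤n+m (count p xs) (𝟙 (p y)))

    count-pos⇒∈ : ∀ xs → 1 ≤ count p xs → Σ[ x ∈ A ] (x ∈ xs × p x ≡ true)
    count-pos⇒∈ (x ∷ xs) pos with p x in px
    ... | true  = x , here refl , px
    ... | false = let (y , y∈ , py) = count-pos⇒∈ xs pos in y , there y∈ , py

    count≡1⇒unique : ∀ {xs x y} → count p xs ≡ 1 →
                     x ∈ xs → p x ≡ true → y ∈ xs → p y ≡ true → y ≡ x
    count≡1⇒unique _ (here refl) _ (here refl) _ = refl
    count≡1⇒unique {z ∷ zs} one (here refl) px (there y∈) py rewrite px =
      contradiction (∈⇒count-pos y∈ py) (<-irrefl (sym (suc-injective one)))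
    count≡1⇒unique {z ∷ zs} one (there x∈) px (here refl) py rewrite py =
      contradiction (∈⇒count-pos x∈ px) (<-irrefl (sym (suc-injective one)))
    count≡1⇒unique {z ∷ zs} one (there x∈) px (there y∈) py with p z
    ... | true  = contradiction (∈⇒count-pos x∈ px) (<-irrefl (sym (suc-injective one)))
    ... | false = count≡1⇒unique one x∈ px y∈ py

    second-witness : ∀ {xs x} → Unique xs → x ∈ xs → p x ≡ true → 1 < count p xs →
                     Σ[ y ∈ A ] (y ∈ xs × p y ≡ true × y ≢ x)
    second-witness {z ∷ zs} (z∉ ∷ _) (here refl) px many rewrite px =
      let (y , y∈ , py) = count-pos⇒∈ zs (≤-pred many) in y , there y∈ , py , All.lookup z∉ y∈ ∘ sym
    second-witness {z ∷ zs} (z∉ ∷ u) (there x∈) px many with p z in pz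
    ... | true  = z , here refl , pz , All.lookup z∉ x∈
    ... | false = let (y , y∈ , py , y≢x) = second-witness u x∈ px many in y , there y∈ , py , y≢x

  module _ {A : Set} (p : A → Bool) where

    ∈-filterᵇ⁺ : ∀ {x xs} → x ∈ xs → p x ≡ true → x ∈ filterᵇ p xs
    ∈-filterᵇ⁺ x∈ px = ∈-filter⁺ (T? ∘ p) x∈ (Equivalence.from T-≡ px)

    ∈-filterᵇ⁻ : ∀ {x xs} → x ∈ filterᵇ p xs → x ∈ xs × p x ≡ true
    ∈-filterᵇ⁻ x∈ = let (x∈xs , px) = ∈-filter⁻ (T? ∘ p) x∈ in x∈xs , Equivalence.to T-≡ px

  ∑-zero : ∀ {n} (f : Fin n → ℕ) → (∀ v → f v ≡ 0) → ∑[ v < n ] f v ≡ 0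
  ∑-zero {zero}  f f≡0 = refl
  ∑-zero {suc n} f f≡0 = cong₂ _+_ (f≡0 zero) (∑-zero (f ∘ suc) (f≡0 ∘ suc))

  ∑-indicator : ∀ {n} (f : Fin n → ℕ) a → ∑[ v < n ] (f v * 𝟙 ⌊ v Fin.≟ a ⌋) ≡ f a
  ∑-indicator {suc n} f zero =
    trans (cong₂ _+_ (ℕ.*-identityʳ (f zero)) (∑-zero _ (λ v → ℕ.*-zeroʳ (f (suc v)))))
          (ℕ.+-identityʳ (f zero))
  ∑-indicator {suc n} f (suc a) =
    trans (cong₂ _+_ (ℕ.*-zeroʳ (f zero)) (sum-cong-≗ λ v → cong (λ b → f (suc v) * 𝟙 b) (⌊suc≟suc⌋ v)))
          (∑-indicator (f ∘ suc) a)
    where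
    ⌊suc≟suc⌋ : ∀ v → ⌊ suc v Fin.≟ suc a ⌋ ≡ ⌊ v Fin.≟ a ⌋
    ⌊suc≟suc⌋ v = ⌊⌋-map′ (cong suc) Fin.suc-injective (v Fin.≟ a)

  ∑-mono-≤ : ∀ {n} {f g : Fin n → ℕ} → (∀ v → f v ≤ g v) → ∑[ v < n ] f v ≤ ∑[ v < n ] g v
  ∑-mono-≤ {zero}  _   = z≤n
  ∑-mono-≤ {suc n} f≤g = ℕ.+-mono-≤ (f≤g zero) (∑-mono-≤ (f≤g ∘ suc))

  ∑-≤-+ : ∀ {n} {f g h : Fin n → ℕ} → (∀ v → f v ≤ g v + h v) →
          ∑[ v < n ] f v ≤ ∑[ v < n ] g v + ∑[ v < n ] h v

  ∑-≤-+ {g = g} {h} f≤g+h = ℕ.≤-trans (∑-mono-≤ f≤g+h) (ℕ.≤-reflexive (∑-distrib-+ g h))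

module Polytopes where

  open import Defs
  open Counting
  open import Function using (_∘_)
  open import Data.Bool using (if_then_else_; _∧_)
  open import Data.Fin.Properties using (_≟_)
  open import Data.List using (List; []; _∷_; map; length; allFin; cartesianProduct)
  open import Data.List.Membership.Propositional using (_∈_)
  open import Data.List.Membership.Propositional.Properties
    using (∈-map⁺; ∈-map⁻; ∈-++⁺ˡ; ∈-++⁺ʳ; ∈-allFin; ∈-cartesianProduct⁺)
  open import Data.List.Relation.Unary.All as All using (All; []; _∷_)
  open import Data.List.Relation.Unary.AllPairs using (AllPairs)
  open import Data.List.Relation.Unary.Any as Any using (here; there)
  open import Data.List.Relation.Unary.Unique.Propositional using (Unique; _∷_)
  import Data.List.Relation.Unary.Unique.Propositional.Properties as Unique
  import Data.Nat as ℕ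
  open import Data.Nat.Properties using (≤-antisym)
  open import Data.Product using (Σ-syntax; _×_; _,_)
  open import Data.Rational using (ℚ; 0ℚ; 1ℚ; _+_; _*_; _-_; -_; _≤_; _<_)
  open import Data.Rational.Properties as ℚ using ()
  open import Data.Rational.Solver using (module +-*-Solver)
  open import Data.Sum using (_⊎_; inj₁; inj₂)
  open import Data.Sum.Properties using (inj₁-injective; inj₂-injective)
  open import Relation.Nullary using (¬_; contradiction; yes; no; ⌊_⌋)
  open import Relation.Nullary.Decidable using (from-yes)
  open import Relation.Binary.PropositionalEquality
    using (_≡_; _≢_; refl; sym; trans; cong; cong₂; subst; module ≡-Reasoning)
  open +-*-Solver using (solve; _:=_; _:+_; _:-_; _:*_; con)

  module _ {I : Set} where

    dot-cong : ∀ idx (c : I → ℚ) {x y : I → ℚ} → (∀ i → x i ≡ y i) → dot idx c x ≡ dot idx c y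
    dot-cong []       c _   = refl
    dot-cong (k ∷ ks) c x≗y = cong₂ (λ a b → c k * a + b) (x≗y k) (dot-cong ks c x≗y)

    dot-comm : ∀ idx (c x : I → ℚ) → dot idx c x ≡ dot idx x c
    dot-comm []       c x = refl
    dot-comm (k ∷ ks) c x = cong₂ _+_ (ℚ.*-comm (c k) (x k)) (dot-comm ks c x)

    dot-+ : ∀ idx (c x y : I → ℚ) → dot idx c (λ i → x i + y i) ≡ dot idx c x + dot idx c y
    dot-+ []       c x y = refl
    dot-+ (k ∷ ks) c x y = trans (cong (c k * (x k + y k) +_) (dot-+ ks c x y))
      (regroup (c k) (x k) (y k) (dot ks c x) (dot ks c y))
      where
      regroup : ∀ a b d r s → a * (b + d) + (r + s) ≡ (a * b + r) + (a * d + s)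
      regroup = solve 5 (λ a b d r s → a :* (b :+ d) :+ (r :+ s) := (a :* b :+ r) :+ (a :* d :+ s)) refl

    dot-zero : ∀ idx (c x : I → ℚ) → (∀ {i} → i ∈ idx → x i ≡ 0ℚ) → dot idx c x ≡ 0ℚ
    dot-zero []       c x _   = refl
    dot-zero (k ∷ ks) c x x≡0 =
      cong₂ _+_ (trans (cong (c k *_) (x≡0 (here refl))) (ℚ.*-zeroʳ (c k))) (dot-zero ks c x (x≡0 ∘ there))

    dot-single : ∀ {idx} (c x : I → ℚ) {a} → Unique idx → a ∈ idx → (∀ i → i ≢ a → x i ≡ 0ℚ) →
                 dot idx c x ≡ c a * x a
    dot-single {k ∷ ks} c x (k∉ ∷ _) (here refl) x≡0 =
      trans (cong (c k * x k +_) (dot-zero ks c x (λ i∈ → x≡0 _ (All.lookup k∉ i∈ ∘ sym))))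
            (ℚ.+-identityʳ _)
    dot-single {k ∷ ks} c x (k∉ ∷ u) (there a∈) x≡0 =
      trans (cong₂ _+_ (trans (cong (c k *_) (x≡0 k (All.lookup k∉ a∈))) (ℚ.*-zeroʳ (c k)))
                       (dot-single c x u a∈ x≡0))
            (ℚ.+-identityˡ _)

  module _ {I : Set} (idx : List I) where

    ≈ₚ-sym : ∀ {u v} → _≈ₚ_ idx u v → _≈ₚ_ idx v u
    ≈ₚ-sym u≈v i = sym (u≈v i)

    ≈ₚ-trans : ∀ {u v w} → _≈ₚ_ idx u v → _≈ₚ_ idx v w → _≈ₚ_ idx u w
    ≈ₚ-trans u≈v v≈w i = trans (u≈v i) (v≈w i)

    SamePair-sym : ∀ {p q} → SamePair idx p q → SamePair idx q p
    SamePair-sym = Unordered-sym {R = _≈ₚ_ idx} ≈ₚ-sym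

    SamePair-trans : ∀ {p q r} → SamePair idx p q → SamePair idx q r → SamePair idx p r
    SamePair-trans = Unordered-trans {R = _≈ₚ_ idx} ≈ₚ-trans

    module _ {S : List (Pt idx)} where

      private
        listed≤ : ∀ {L L′} → All (λ { (u , v) → IsEdge idx S u v }) L →
                  AllPairs (λ p q → ¬ SamePair idx p q) L →
                  (∀ u v → IsEdge idx S u v → Σ[ q ∈ _ ] (q ∈ L′ × SamePair idx (u , v) q)) →
                  length L ℕ.≤ length L′
        listed≤ edges distinct complete′ = length-≤ SamePair-sym SamePair-trans distinct λ {(u , v)} p∈ →
          let (q , q∈ , same) = complete′ u v (All.lookup edges p∈)
          in Any.map (λ { refl → same }) q∈

      EdgeCount-unique : ∀ {k k′} → EdgeCount idx S k → EdgeCount idx S k′ → k ≡ k′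
      EdgeCount-unique (L , refl , edges , distinct , complete) (L′ , refl , edges′ , distinct′ , complete′) =
        ≤-antisym (listed≤ edges distinct complete′) (listed≤ edges′ distinct′ complete)

  module _ {I : Set} (idx : List I) {S : List (Pt idx)} where

    IsEdge-sym : ∀ {u v} → IsEdge idx S u v → IsEdge idx S v u
    IsEdge-sym {u} {v} (u∈ , v∈ , u≉v , c , cu≡cv , maximal) =
      v∈ , u∈ , u≉v ∘ ≈ₚ-sym idx , c , sym cu≡cv , All.map flip maximal
      where
      reverse : ∀ {w} → OnSegment idx u v w → OnSegment idx v u w
      reverse (t , 0≤t , t≤1 , w≡) =
        1ℚ - t , ℚ.≤-trans (ℚ.≤-reflexive (sym (ℚ.+-inverseʳ t))) (ℚ.+-monoˡ-≤ (- t) t≤1) ,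
        ℚ.+-monoʳ-≤ 1ℚ (ℚ.neg-antimono-≤ 0≤t) , λ i → trans (w≡ i) (swap t (u i) (v i))
        where
        swap : ∀ t a b → t * a + (1ℚ - t) * b ≡ (1ℚ - t) * b + (1ℚ - (1ℚ - t)) * a
        swap = solve 3 (λ t a b → t :* a :+ (con 1ℚ :- t) :* b
                                  := (con 1ℚ :- t) :* b :+ (con 1ℚ :- (con 1ℚ :- t)) :* a) refl
      flip : ∀ {w} → dot idx c w ≤ dot idx c u × (dot idx c w ≡ dot idx c u → OnSegment idx u v w) →
                     dot idx c w ≤ dot idx c v × (dot idx c w ≡ dot idx c v → OnSegment idx v u w)
      flip (≤u , onSeg) = subst (_ ≤_) cu≡cv ≤u , λ ≡v → reverse (onSeg (trans ≡v (sym cu≡cv)))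

    IsEdge-byFunctional : ∀ {u v} → u ∈ S → v ∈ S → ¬ _≈ₚ_ idx u v → (c : Pt idx) →
      dot idx c u ≡ dot idx c v →
      All (λ w → dot idx c w < dot idx c u ⊎ _≈ₚ_ idx w u ⊎ _≈ₚ_ idx w v) S →
      IsEdge idx S u v
    IsEdge-byFunctional {u} {v} u∈ v∈ u≉v c cu≡cv below =
      u∈ , v∈ , u≉v , c , cu≡cv , All.map maximal below
      where
      at-u : ∀ a b → a ≡ 1ℚ * a + (1ℚ - 1ℚ) * b
      at-u = solve 2 (λ a b → a := con 1ℚ :* a :+ (con 1ℚ :- con 1ℚ) :* b) refl
      at-v : ∀ a b → b ≡ 0ℚ * a + (1ℚ - 0ℚ) * b
      at-v = solve 2 (λ a b → b := con 0ℚ :* a :+ (con 1ℚ :- con 0ℚ) :* b) refl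
      0≤1 : 0ℚ ≤ 1ℚ
      0≤1 = from-yes (0ℚ ℚ.≤? 1ℚ)
      maximal : ∀ {w} → dot idx c w < dot idx c u ⊎ _≈ₚ_ idx w u ⊎ _≈ₚ_ idx w v →
                dot idx c w ≤ dot idx c u × (dot idx c w ≡ dot idx c u → OnSegment idx u v w)
      maximal (inj₁ cw<cu) = ℚ.<⇒≤ cw<cu , λ cw≡cu → contradiction cw<cu (ℚ.<-irrefl cw≡cu)
      maximal (inj₂ (inj₁ w≈u)) = ℚ.≤-reflexive (dot-cong idx c w≈u) ,
        λ _ → 1ℚ , 0≤1 , ℚ.≤-refl , λ i → trans (w≈u i) (at-u (u i) (v i))
      maximal (inj₂ (inj₂ w≈v)) = ℚ.≤-reflexive (trans (dot-cong idx c w≈v) (sym cu≡cv)) ,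
        λ _ → 0ℚ , ℚ.≤-refl , 0≤1 , λ i → trans (w≈v i) (at-v (u i) (v i))

    sharedMidpoint⇒¬IsEdge : ∀ {u v w₁ w₂} → w₁ ∈ S → w₂ ∈ S →
      (∀ c → dot idx c w₁ + dot idx c w₂ ≡ dot idx c u + dot idx c v) →
      ∀ a → u a ≡ 0ℚ → v a ≡ 0ℚ → w₁ a ≢ 0ℚ → ¬ IsEdge idx S u v
    sharedMidpoint⇒¬IsEdge {u} {v} {w₁} {w₂} w₁∈ w₂∈ midpoint a ua≡0 va≡0 w₁a≢0
                           (_ , _ , _ , c , cu≡cv , maximal)
      with All.lookup maximal w₁∈ | All.lookup maximal w₂∈
    ... | ≤₁ , onSeg | ≤₂ , _
      with onSeg (summands-max ≤₁ ≤₂ (trans (midpoint c) (cong (dot idx c u +_) (sym cu≡cv))))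
      where
      summands-max : ∀ {x y m} → x ≤ m → y ≤ m → x + y ≡ m + m → x ≡ m
      summands-max x≤m y≤m x+y≡ = ℚ.≤-antisym x≤m (ℚ.≮⇒≥ λ x<m → ℚ.<-irrefl x+y≡ (ℚ.+-mono-<-≤ x<m y≤m))
    ... | t , _ , _ , w₁≡ =
      w₁a≢0 (trans (w₁≡ a) (trans (cong₂ (λ p q → t * p + (1ℚ - t) * q) ua≡0 va≡0) (vanish t)))
      where
      vanish : ∀ t → t * 0ℚ + (1ℚ - t) * 0ℚ ≡ 0ℚ
      vanish = solve 1 (λ t → t :* con 0ℚ :+ (con 1ℚ :- t) :* con 0ℚ := con 0ℚ) refl

  module _ {n : ℕ.ℕ} where

    unit : Coord n → ℚ → Coord n → ℚ
    unit (inj₁ i)       r (inj₁ k)       = if ⌊ k ≟ i ⌋ then r else 0ℚ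
    unit (inj₂ (i , j)) r (inj₂ (k , l)) = if ⌊ k ≟ i ⌋ ∧ ⌊ l ≟ j ⌋ then r else 0ℚ
    unit (inj₁ _)       r (inj₂ _)       = 0ℚ
    unit (inj₂ _)       r (inj₁ _)       = 0ℚ

    unit-self : ∀ a r → unit a r a ≡ r
    unit-self (inj₁ i) r with i ≟ i
    ... | yes _  = refl
    ... | no i≢i = contradiction refl i≢i
    unit-self (inj₂ (i , j)) r with i ≟ i | j ≟ j
    ... | yes _  | yes _  = refl
    ... | no i≢i | _      = contradiction refl i≢i
    ... | yes _  | no j≢j = contradiction refl j≢j

    unit-off : ∀ a r k → k ≢ a → unit a r k ≡ 0ℚ
    unit-off (inj₁ i) r (inj₁ k) k≢a with k ≟ i
    ... | yes refl = contradiction refl k≢a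
    ... | no _     = refl
    unit-off (inj₂ (i , j)) r (inj₂ (k , l)) k≢a with k ≟ i | l ≟ j
    ... | yes refl | yes refl = contradiction refl k≢a
    ... | yes _    | no _     = refl
    ... | no _     | _        = refl
    unit-off (inj₁ _) r (inj₂ _) _ = refl
    unit-off (inj₂ _) r (inj₁ _) _ = refl

    coords-unique : Unique (coords n)
    coords-unique = Unique.++⁺ (Unique.map⁺ inj₁-injective (Unique.allFin⁺ n))
      (Unique.map⁺ inj₂-injective (Unique.cartesianProduct⁺ (Unique.allFin⁺ n) (Unique.allFin⁺ n))) disjoint
      where
      disjoint : ∀ {a} → ¬ (a ∈ map inj₁ (allFin n) ×
                            a ∈ map inj₂ (cartesianProduct (allFin n) (allFin n)))
      disjoint (a∈₁ , a∈₂) with ∈-map⁻ inj₁ a∈₁ | ∈-map⁻ inj₂ a∈₂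
      ... | _ , _ , refl | _ , _ , ()

    ∈-coords : ∀ a → a ∈ coords n
    ∈-coords (inj₁ i)       = ∈-++⁺ˡ (∈-map⁺ inj₁ (∈-allFin i))
    ∈-coords (inj₂ (i , j)) =
      ∈-++⁺ʳ (map inj₁ (allFin n)) (∈-map⁺ inj₂ (∈-cartesianProduct⁺ (∈-allFin i) (∈-allFin j)))

    dot-unit : ∀ c a r → dot (coords n) c (unit a r) ≡ c a * r
    dot-unit c a r = trans (dot-single c (unit a r) coords-unique (∈-coords a) (λ k → unit-off a r k))
                           (cong (c a *_) (unit-self a r))

    vec-units : ∀ α β γ i j k →
      vec α β γ i j k ≡ unit (inj₁ i) α k + unit (inj₁ j) β k + unit (inj₂ (i , j)) γ k
    vec-units α β γ i j (inj₁ k) = sym (ℚ.+-identityʳ _)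
    vec-units α β γ i j (inj₂ l) = sym (ℚ.+-identityˡ _)

    dot-vec : ∀ c α β γ i j →
      dot (coords n) c (vec α β γ i j) ≡ c (inj₁ i) * α + c (inj₁ j) * β + c (inj₂ (i , j)) * γ
    dot-vec c α β γ i j = begin
      dot (coords n) c (vec α β γ i j)
        ≡⟨ dot-cong (coords n) c (vec-units α β γ i j) ⟩
      dot (coords n) c (λ k → eᵢ k + eⱼ k + eᵢⱼ k)
        ≡⟨ dot-+ (coords n) c (λ k → eᵢ k + eⱼ k) eᵢⱼ ⟩
      dot (coords n) c (λ k → eᵢ k + eⱼ k) + dot (coords n) c eᵢⱼ
        ≡⟨ cong (_+ dot (coords n) c eᵢⱼ) (dot-+ (coords n) c eᵢ eⱼ) ⟩
      dot (coords n) c eᵢ + dot (coords n) c eⱼ + dot (coords n) c eᵢⱼ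
        ≡⟨ cong₂ _+_ (cong₂ _+_ (dot-unit c (inj₁ i) α) (dot-unit c (inj₁ j) β))
                     (dot-unit c (inj₂ (i , j)) γ) ⟩
      c (inj₁ i) * α + c (inj₁ j) * β + c (inj₂ (i , j)) * γ ∎
      where
      open ≡-Reasoning
      eᵢ eⱼ eᵢⱼ : Coord n → ℚ
      eᵢ = unit (inj₁ i) α
      eⱼ = unit (inj₁ j) β
      eᵢⱼ = unit (inj₂ (i , j)) γ

    dot-coordinate : ∀ a x → dot (coords n) (unit a 1ℚ) x ≡ x a
    dot-coordinate a x =
      trans (dot-comm (coords n) (unit a 1ℚ) x) (trans (dot-unit x a 1ℚ) (ℚ.*-identityʳ (x a)))

module Graphs where

  open import Defs
  open Counting
  open import Function using (_∘_)
  import Data.Nat.Properties as ℕ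
  open import Algebra.Properties.Semiring.Sum ℕ.+-*-semiring using (sum-syntax; sum-cong-≗; ∑-distrib-+)
  open import Data.Bool using (Bool; true; false; _∧_; _∨_)
  import Data.Bool as Bool
  open import Data.Bool.Properties using (∨-zeroʳ)
  open import Data.Fin using (Fin; zero; suc) renaming (_<_ to _<ᶠ_)
  open import Data.Fin.Properties using (_≟_; _<?_; <⇒≢; <-asym)
  open import Data.List using (List; []; _∷_; map; allFin; cartesianProduct)
  open import Data.List.Membership.Propositional using (_∈_)
  open import Data.List.Membership.Propositional.Properties
    using (∈-filter⁺; ∈-filter⁻; ∈-allFin; ∈-cartesianProduct⁺)
  open import Data.List.Relation.Unary.All using (All; []; _∷_)
  open import Data.List.Relation.Unary.Unique.Propositional using (Unique)
  import Data.List.Relation.Unary.Unique.Propositional.Properties as Unique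
  open import Data.Nat using (ℕ; zero; suc; _+_; _*_; _≤_; _<_; s≤s; z≤n)
  open import Data.Nat.ListAction using (sum)
  open import Data.Product using (Σ-syntax; _×_; _,_; proj₁; proj₂; uncurry)
  open import Data.Sum using (_⊎_; inj₁; inj₂)
  open import Relation.Binary.Definitions using (DecidableEquality)
  open import Relation.Nullary using (contradiction; yes; no; does; ⌊_⌋)
  open import Relation.Nullary.Decidable using (map′; _×-dec_)
  open import Relation.Binary.PropositionalEquality
    using (_≡_; _≢_; refl; sym; trans; cong; cong₂; module ≡-Reasoning)

  Arc : ℕ → Set
  Arc n = Fin n × Fin n

  isOne : ℕ → Bool
  isOne 1             = true
  isOne zero          = false
  isOne (suc (suc _)) = false

  module _ {n : ℕ} where

    _≟ₐ_ : DecidableEquality (Arc n)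
    (i , j) ≟ₐ (k , l) = map′ (uncurry (cong₂ _,_)) (λ { refl → refl , refl }) (i ≟ k ×-dec j ≟ l)

    Loopless : Arc n → Set
    Loopless (i , j) = i ≢ j

    incident : Fin n → Arc n → Bool
    incident v (a , b) = ⌊ v ≟ a ⌋ ∨ ⌊ v ≟ b ⌋

    incident-left : ∀ a b → incident a (a , b) ≡ true
    incident-left a b = cong (_∨ ⌊ a ≟ b ⌋) (⌊≟⌋-refl _≟_ a)

    incident-right : ∀ a b → incident b (a , b) ≡ true
    incident-right a b = trans (cong (⌊ b ≟ a ⌋ ∨_) (⌊≟⌋-refl _≟_ b)) (∨-zeroʳ _)

    SoleArcAt : List (Arc n) → Fin n → Arc n → Set
    SoleArcAt gs v g = ∀ {h} → h ∈ gs → incident v h ≡ true → h ≡ g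

    degree : List (Arc n) → Fin n → ℕ
    degree gs v = count (incident v) gs

    isLeaf : List (Arc n) → Fin n → Bool
    isLeaf gs v = isOne (degree gs v)

    isLeaf⇒sole : ∀ {gs} v {g} → isLeaf gs v ≡ true → g ∈ gs → incident v g ≡ true → SoleArcAt gs v g
    isLeaf⇒sole {gs} v leaf g∈ vg h∈ vh = count≡1⇒unique (isOne⇒≡1 (degree gs v) leaf) g∈ vg h∈ vh
      where
      isOne⇒≡1 : ∀ d → isOne d ≡ true → d ≡ 1
      isOne⇒≡1 1 _ = refl

    ¬isLeaf⇒another : ∀ {gs} v {g} → Unique gs → g ∈ gs → incident v g ≡ true → isLeaf gs v ≡ false →
                      Σ[ h ∈ Arc n ] (h ∈ gs × incident v h ≡ true × h ≢ g)
    ¬isLeaf⇒another {gs} v u g∈ vg notLeaf =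
      second-witness u g∈ vg (>1 (degree gs v) (∈⇒count-pos g∈ vg) notLeaf)
      where
      >1 : ∀ d → 1 ≤ d → isOne d ≡ false → 1 < d
      >1 (suc (suc d)) _ _ = s≤s (s≤s z≤n)

    incident-split : ∀ v {i j : Fin n} → i ≢ j → 𝟙 (incident v (i , j)) ≡ 𝟙 ⌊ v ≟ i ⌋ + 𝟙 ⌊ v ≟ j ⌋
    incident-split v {i} {j} i≢j with v ≟ i | v ≟ j
    ... | yes refl | yes refl = contradiction refl i≢j
    ... | yes _    | no _     = refl
    ... | no _     | yes _    = refl
    ... | no _     | no _     = refl

    distinct-ordered-arcs : ∀ {i j k l : Fin n} → i <ᶠ j → k <ᶠ l → (i , j) ≢ (k , l) →
                            (i ≢ k × i ≢ l) ⊎ (j ≢ k × j ≢ l)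
    distinct-ordered-arcs {i} {j} {k} {l} i<j k<l g≢h with i ≟ k | i ≟ l
    ... | no i≢k   | no i≢l   = inj₁ (i≢k , i≢l)
    ... | yes refl | _        = inj₂ (<⇒≢ i<j ∘ sym , λ { refl → g≢h refl })
    ... | no _     | yes refl = inj₂ ((λ { refl → <-asym i<j k<l }) , <⇒≢ i<j ∘ sym)

    pairs-unique : Unique (pairs n)
    pairs-unique = Unique.filter⁺ _ (Unique.cartesianProduct⁺ (Unique.allFin⁺ n) (Unique.allFin⁺ n))

    ∈-pairs : ∀ {i j : Fin n} → i <ᶠ j → (i , j) ∈ pairs n
    ∈-pairs {i} {j} i<j =
      ∈-filter⁺ (λ { (i , j) → i <? j }) (∈-cartesianProduct⁺ (∈-allFin i) (∈-allFin j)) i<j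

    arcs-unique : ∀ (X : Config n) → Unique (arcs X)
    arcs-unique X = Unique.filter⁺ _ pairs-unique

    arcs-ordered : ∀ (X : Config n) {g} → g ∈ arcs X → proj₁ g <ᶠ proj₂ g
    arcs-ordered X g∈ = proj₂ (∈-filter⁻ (λ { (i , j) → i <? j }) {xs = cartesianProduct (allFin n) (allFin n)}
      (proj₁ (∈-filter⁻ (λ { (i , j) → X i j Bool.≟ true }) {xs = pairs n} g∈)))

    set-same : ∀ (Z : Config n) i j b → set Z i j b i j ≡ b
    set-same Z i j b rewrite ⌊≟⌋-refl _≟_ i | ⌊≟⌋-refl _≟_ j = refl

    set-other : ∀ (Z : Config n) i j b {a c} → (a , c) ≢ (i , j) → set Z i j b a c ≡ Z a c
    set-other Z i j b {a} {c} ac≢ij with a ≟ i | c ≟ j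
    ... | yes refl | yes refl = contradiction refl ac≢ij
    ... | yes _    | no _     = refl
    ... | no _     | _        = refl

    set-comm : ∀ (Z : Config n) {i j k l} b b′ → (i , j) ≢ (k , l) →
               ∀ a c → set (set Z i j b) k l b′ a c ≡ set (set Z k l b′) i j b a c
    set-comm Z {i} {j} {k} {l} b b′ e≢f a c with (a , c) ≟ₐ (i , j) | (a , c) ≟ₐ (k , l)
    ... | yes refl | _        = trans (set-other (set Z i j b) k l b′ e≢f)
                                  (trans (set-same Z i j b) (sym (set-same (set Z k l b′) i j b)))
    ... | no _     | yes refl = trans (set-same (set Z i j b) k l b′)
                                  (sym (trans (set-other (set Z k l b′) i j b (e≢f ∘ sym)) (set-same Z k l b′)))
    ... | no ≢e    | no ≢f    = trans (set-other (set Z i j b) k l b′ ≢f) (trans (set-other Z i j b ≢e)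
                                  (sym (trans (set-other (set Z k l b′) i j b ≢e) (set-other Z k l b′ ≢f))))

    count-arcs : ∀ (Z : Config n) w → count w (arcs Z) ≡ count (λ g → Z (proj₁ g) (proj₂ g) ∧ w g) (pairs n)
    count-arcs Z w = trans (count-filter _ w (pairs n))
      (count-cong (pairs n) λ { {a , c} _ → cong (_∧ w (a , c)) (does-≟true (Z a c)) })
      where
      does-≟true : ∀ b → does (b Bool.≟ true) ≡ b
      does-≟true true  = refl
      does-≟true false = refl

    count-arcs-cong : ∀ {Z Z′ : Config n} w → (∀ a c → Z a c ≡ Z′ a c) →
                      count w (arcs Z) ≡ count w (arcs Z′)
    count-arcs-cong {Z} {Z′} w Z≗Z′ = trans (count-arcs Z w)
      (trans (count-cong (pairs n) (λ { {a , c} _ → cong (_∧ w (a , c)) (Z≗Z′ a c) })) (sym (count-arcs Z′ w)))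

    count-arcs-set : ∀ (Z : Config n) {i j} → i <ᶠ j → ∀ w →
                     count w (arcs (set Z i j true)) ≡ count w (arcs (set Z i j false)) + 𝟙 (w (i , j))
    count-arcs-set Z {i} {j} i<j w = begin
      count w (arcs (set Z i j true))
        ≡⟨ count-arcs (set Z i j true) w ⟩
      count (λ g → set Z i j true (proj₁ g) (proj₂ g) ∧ w g) (pairs n)
        ≡⟨ count-toggle pairs-unique (∈-pairs i<j) agree (cong (_∧ w (i , j)) (set-same Z i j false)) ⟩
      count (λ g → set Z i j false (proj₁ g) (proj₂ g) ∧ w g) (pairs n) + 𝟙 (set Z i j true i j ∧ w (i , j))
        ≡⟨ cong₂ _+_ (sym (count-arcs (set Z i j false) w))
                     (cong (λ b → 𝟙 (b ∧ w (i , j))) (set-same Z i j true)) ⟩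
      count w (arcs (set Z i j false)) + 𝟙 (w (i , j)) ∎
      where
      open ≡-Reasoning
      agree : ∀ {g} → g ≢ (i , j) →
              set Z i j true (proj₁ g) (proj₂ g) ∧ w g ≡ set Z i j false (proj₁ g) (proj₂ g) ∧ w g
      agree {a , c} g≢e =
        cong (_∧ w (a , c)) (trans (set-other Z i j true g≢e) (sym (set-other Z i j false g≢e)))

    set-overwrite : ∀ (Z : Config n) i j b b′ b″ a c →
                    set (set Z i j b) i j b′ a c ≡ set (set Z i j b″) i j b′ a c
    set-overwrite Z i j b b′ b″ a c with ⌊ a ≟ i ⌋ ∧ ⌊ c ≟ j ⌋
    ... | true  = refl
    ... | false = refl

  module _ {n : ℕ} where

    double-counting : ∀ (f : Fin n → ℕ) {gs} → All Loopless gs →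
      sum (map (λ g → f (proj₁ g) + f (proj₂ g)) gs) ≡ ∑[ v < n ] (f v * degree gs v)
    double-counting f {[]} [] = sym (∑-zero _ (λ v → ℕ.*-zeroʳ (f v)))
    double-counting f {(i , j) ∷ gs} (i≢j ∷ loopless) = sym (begin
      ∑[ v < n ] (f v * (𝟙 (incident v (i , j)) + degree gs v))
        ≡⟨ sum-cong-≗ (λ v → trans (ℕ.*-distribˡ-+ (f v) _ _)
                                   (cong (λ d → f v * d + _) (incident-split v i≢j))) ⟩
      ∑[ v < n ] (f v * (𝟙 ⌊ v ≟ i ⌋ + 𝟙 ⌊ v ≟ j ⌋) + f v * degree gs v)
        ≡⟨ ∑-distrib-+ (λ v → f v * (𝟙 ⌊ v ≟ i ⌋ + 𝟙 ⌊ v ≟ j ⌋)) (λ v → f v * degree gs v) ⟩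
      ∑[ v < n ] (f v * (𝟙 ⌊ v ≟ i ⌋ + 𝟙 ⌊ v ≟ j ⌋)) + ∑[ v < n ] (f v * degree gs v)
        ≡⟨ cong₂ _+_ endpoints (sym (double-counting f loopless)) ⟩
      f i + f j + sum (map (λ g → f (proj₁ g) + f (proj₂ g)) gs) ∎)
      where
      open ≡-Reasoning
      endpoints : ∑[ v < n ] (f v * (𝟙 ⌊ v ≟ i ⌋ + 𝟙 ⌊ v ≟ j ⌋)) ≡ f i + f j
      endpoints = trans (sum-cong-≗ (λ v → ℕ.*-distribˡ-+ (f v) _ _))
        (trans (∑-distrib-+ (λ v → f v * 𝟙 ⌊ v ≟ i ⌋) (λ v → f v * 𝟙 ⌊ v ≟ j ⌋))
               (cong₂ _+_ (∑-indicator f i) (∑-indicator f j)))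

module CosmologicalPoints where

  open import Defs
  open Counting
  open Polytopes
  open Graphs
  open import Function using (_∘_)
  open import Data.List using (List; []; _∷_; map; concatMap)
  open import Data.List.Membership.Propositional using (_∈_)
  open import Data.List.Membership.Propositional.Properties using (∈-map⁺)
  open import Data.List.Relation.Unary.All as All using (All; []; _∷_)
  import Data.List.Relation.Unary.All.Properties as All
  open import Data.List.Relation.Unary.AllPairs using (AllPairs; []; _∷_)
  open import Data.List.Relation.Unary.Any using (here; there)
  open import Data.List.Relation.Unary.Unique.Propositional using (Unique)
  open import Data.Nat using (ℕ)
  open import Data.Product using (_×_; _,_; proj₁; proj₂)
  open import Data.Rational using (ℚ; 0ℚ; 1ℚ; _+_; -_; _<_)
  open import Data.Rational.Properties as ℚ using ()
  open import Data.Sum using (_⊎_; inj₁; inj₂)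
  open import Data.Sum.Properties using (inj₁-injective; inj₂-injective)
  open import Relation.Binary.Definitions using (DecidableEquality)
  open import Relation.Nullary using (¬_; contradiction; yes; no)
  open import Relation.Nullary.Decidable using (from-yes)
  open import Relation.Binary.PropositionalEquality using (_≡_; _≢_; refl; sym; trans; cong; cong₂; subst; subst₂)

  data Kind : Set where
    negArc negRight negLeft : Kind

  _≟ₖ_ : DecidableEquality Kind
  negArc   ≟ₖ negArc   = yes refl
  negRight ≟ₖ negRight = yes refl
  negLeft  ≟ₖ negLeft  = yes refl
  negArc   ≟ₖ negRight = no λ ()
  negArc   ≟ₖ negLeft  = no λ ()
  negRight ≟ₖ negArc   = no λ ()
  negRight ≟ₖ negLeft  = no λ ()
  negLeft  ≟ₖ negArc   = no λ ()
  negLeft  ≟ₖ negRight = no λ ()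

  coefˡ coefʳ coefᵃ : Kind → ℚ
  coefˡ negArc   = 1ℚ
  coefˡ negRight = 1ℚ
  coefˡ negLeft  = - 1ℚ
  coefʳ negArc   = 1ℚ
  coefʳ negRight = - 1ℚ
  coefʳ negLeft  = 1ℚ
  coefᵃ negArc   = - 1ℚ
  coefᵃ negRight = 1ℚ
  coefᵃ negLeft  = 1ℚ

  Label : ℕ → Set
  Label n = Arc n × Kind

  module _ {n : ℕ} where

    infix 7 _·_
    infix 4 _≈_

    _·_ : (Coord n → ℚ) → (Coord n → ℚ) → ℚ
    c · x = dot (coords n) c x

    _≈_ : (Coord n → ℚ) → (Coord n → ℚ) → Set
    _≈_ = _≈ₚ_ (coords n)

    _≟ₗ_ : DecidableEquality (Label n)
    (g , κ) ≟ₗ (h , σ) with g ≟ₐ h | κ ≟ₖ σ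
    ... | yes refl | yes refl = yes refl
    ... | no g≢h   | _        = no (g≢h ∘ cong proj₁)
    ... | yes _    | no κ≢σ   = no (κ≢σ ∘ cong proj₂)

    point : Label n → Coord n → ℚ
    point ((i , j) , κ) = vec (coefˡ κ) (coefʳ κ) (coefᵃ κ) i j

    labels : List (Arc n) → List (Label n)
    labels []       = []
    labels (g ∷ gs) = (g , negArc) ∷ (g , negRight) ∷ (g , negLeft) ∷ labels gs

    Points : List (Arc n) → List (Coord n → ℚ)
    Points gs = map point (labels gs)

    Edge : List (Arc n) → Label n → Label n → Set
    Edge gs ℓ ℓ′ = IsEdge (coords n) (Points gs) (point ℓ) (point ℓ′)

    cosmoPts≡Points : ∀ (X : Config n) → cosmoPts X ≡ Points (arcs X)
    cosmoPts≡Points X = go (arcs X)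
      where
      go : ∀ gs → concatMap (λ { (i , j) → vec 1ℚ 1ℚ (- 1ℚ) i j ∷ vec 1ℚ (- 1ℚ) 1ℚ i j ∷ vec (- 1ℚ) 1ℚ 1ℚ i j ∷ [] }) gs
                  ≡ Points gs
      go []       = refl
      go (g ∷ gs) = cong (λ ps → point (g , negArc) ∷ point (g , negRight) ∷ point (g , negLeft) ∷ ps) (go gs)

    point-arc : ∀ g κ → point (g , κ) (inj₂ g) ≡ coefᵃ κ
    point-arc (i , j) κ = unit-self (inj₂ (i , j)) (coefᵃ κ)

    point-offArc : ∀ g κ h → h ≢ g → point (g , κ) (inj₂ h) ≡ 0ℚ
    point-offArc (i , j) κ h h≢g = unit-off (inj₂ (i , j)) (coefᵃ κ) (inj₂ h) (h≢g ∘ inj₂-injective)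

    point-left : ∀ {i j} κ → i ≢ j → point ((i , j) , κ) (inj₁ i) ≡ coefˡ κ
    point-left {i} {j} κ i≢j =
      trans (cong₂ _+_ (unit-self (inj₁ i) (coefˡ κ)) (unit-off (inj₁ j) (coefʳ κ) (inj₁ i) (i≢j ∘ inj₁-injective)))
            (ℚ.+-identityʳ (coefˡ κ))

    point-right : ∀ {i j} κ → i ≢ j → point ((i , j) , κ) (inj₁ j) ≡ coefʳ κ
    point-right {i} {j} κ i≢j =
      trans (cong₂ _+_ (unit-off (inj₁ i) (coefˡ κ) (inj₁ j) (i≢j ∘ sym ∘ inj₁-injective)) (unit-self (inj₁ j) (coefʳ κ)))
            (ℚ.+-identityˡ (coefʳ κ))

    point-offNode : ∀ {i j} κ v → v ≢ i → v ≢ j → point ((i , j) , κ) (inj₁ v) ≡ 0ℚ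
    point-offNode {i} {j} κ v v≢i v≢j =
      cong₂ _+_ (unit-off (inj₁ i) (coefˡ κ) (inj₁ v) (v≢i ∘ inj₁-injective))
                (unit-off (inj₁ j) (coefʳ κ) (inj₁ v) (v≢j ∘ inj₁-injective))

    point-injective : ∀ {g κ h σ} → Loopless g → point (g , κ) ≈ point (h , σ) → (g , κ) ≡ (h , σ)
    point-injective {g@(i , j)} {κ} {h} {σ} i≢j same with g ≟ₐ h
    ... | no g≢h =
      contradiction (trans (sym (point-arc g κ)) (trans (same (inj₂ g)) (point-offArc h σ g g≢h))) (coefᵃ≢0 κ)
      where
      coefᵃ≢0 : ∀ κ → coefᵃ κ ≢ 0ℚ
      coefᵃ≢0 negArc   ()
      coefᵃ≢0 negRight ()
      coefᵃ≢0 negLeft  ()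
    ... | yes refl = cong (g ,_) (kind-injective κ σ
      (trans (sym (point-left κ i≢j)) (trans (same (inj₁ i)) (point-left σ i≢j)))
      (trans (sym (point-right κ i≢j)) (trans (same (inj₁ j)) (point-right σ i≢j))))
      where
      kind-injective : ∀ κ σ → coefˡ κ ≡ coefˡ σ → coefʳ κ ≡ coefʳ σ → κ ≡ σ
      kind-injective negArc   negArc   _  _  = refl
      kind-injective negRight negRight _  _  = refl
      kind-injective negLeft  negLeft  _  _  = refl
      kind-injective negArc   negRight _  ()
      kind-injective negArc   negLeft  () _
      kind-injective negRight negArc   _  ()
      kind-injective negRight negLeft  () _
      kind-injective negLeft  negArc   () _
      kind-injective negLeft  negRight () _

    distinct-kinds : ∀ {g} κ σ → Loopless g → κ ≢ σ → ¬ point (g , κ) ≈ point (g , σ)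
    distinct-kinds _ _ loopless κ≢σ = κ≢σ ∘ cong proj₂ ∘ point-injective loopless

    ∈-labels⁻ : ∀ gs {ℓ : Label n} → ℓ ∈ labels gs → proj₁ ℓ ∈ gs
    ∈-labels⁻ (g ∷ gs) (here refl)                 = here refl
    ∈-labels⁻ (g ∷ gs) (there (here refl))         = here refl
    ∈-labels⁻ (g ∷ gs) (there (there (here refl))) = here refl
    ∈-labels⁻ (g ∷ gs) (there (there (there ℓ∈))) = there (∈-labels⁻ gs ℓ∈)

    ∈-labels⁺ : ∀ {gs g} κ → g ∈ gs → (g , κ) ∈ labels gs
    ∈-labels⁺ negArc   (here refl) = here refl
    ∈-labels⁺ negRight (here refl) = there (here refl)
    ∈-labels⁺ negLeft  (here refl) = there (there (here refl))
    ∈-labels⁺ κ        (there g∈)  = there (there (there (∈-labels⁺ κ g∈)))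

    labels-unique : ∀ {gs} → Unique gs → Unique (labels gs)
    labels-unique {[]}     []       = []
    labels-unique {g ∷ gs} (g∉ ∷ u) =
      ((λ ()) ∷ (λ ()) ∷ other-arcs negArc) ∷ ((λ ()) ∷ other-arcs negRight) ∷ other-arcs negLeft ∷
      labels-unique u
      where
      other-arcs : ∀ κ → All ((g , κ) ≢_) (labels gs)
      other-arcs κ = All.tabulate λ ℓ∈ eq → All.lookup g∉ (∈-labels⁻ gs ℓ∈) (cong proj₁ eq)

    labels-distinct : ∀ {gs} → Unique gs → All Loopless gs → AllPairs (λ ℓ m → ¬ point ℓ ≈ point m) (labels gs)
    labels-distinct {gs} u loopless = AllPairs-mapWith (λ loopless ℓ≢m → ℓ≢m ∘ point-injective loopless)
      (All.tabulate λ ℓ∈ → All.lookup loopless (∈-labels⁻ gs ℓ∈)) (labels-unique u)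

    Edge-byFunctional : ∀ gs {ℓ ℓ′} → ℓ ∈ labels gs → ℓ′ ∈ labels gs → ¬ point ℓ ≈ point ℓ′ →
      (c : Coord n → ℚ) → c · point ℓ ≡ c · point ℓ′ →
      (∀ {m} → m ∈ labels gs → m ≢ ℓ → m ≢ ℓ′ → c · point m < c · point ℓ) → Edge gs ℓ ℓ′
    Edge-byFunctional gs {ℓ} {ℓ′} ℓ∈ ℓ′∈ ℓ≉ℓ′ c cℓ≡cℓ′ below =
      IsEdge-byFunctional (coords n) (∈-map⁺ point ℓ∈) (∈-map⁺ point ℓ′∈) ℓ≉ℓ′ c cℓ≡cℓ′
        (All.map⁺ (All.tabulate classify))
      where
      classify : ∀ {m} → m ∈ labels gs → c · point m < c · point ℓ ⊎ point m ≈ point ℓ ⊎ point m ≈ point ℓ′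
      classify {m} m∈ with m ≟ₗ ℓ | m ≟ₗ ℓ′
      ... | yes refl | _        = inj₂ (inj₁ λ _ → refl)
      ... | no _     | yes refl = inj₂ (inj₂ λ _ → refl)
      ... | no m≢ℓ   | no m≢ℓ′  = inj₁ (below m∈ m≢ℓ m≢ℓ′)

    Edge-byCoordinate : ∀ gs {ℓ ℓ′} → ℓ ∈ labels gs → ℓ′ ∈ labels gs → ¬ point ℓ ≈ point ℓ′ →
      ∀ a → point ℓ a ≡ 1ℚ → point ℓ′ a ≡ 1ℚ →
      (∀ {m} → m ∈ labels gs → m ≢ ℓ → m ≢ ℓ′ → point m a < 1ℚ) → Edge gs ℓ ℓ′
    Edge-byCoordinate gs {ℓ} {ℓ′} ℓ∈ ℓ′∈ ℓ≉ℓ′ a ℓa≡1 ℓ′a≡1 below =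
      Edge-byFunctional gs ℓ∈ ℓ′∈ ℓ≉ℓ′ (unit a 1ℚ)
        (trans (value ℓ) (trans ℓa≡1 (trans (sym ℓ′a≡1) (sym (value ℓ′)))))
        (λ {m} m∈ m≢ℓ m≢ℓ′ → subst₂ _<_ (sym (value m)) (trans (sym ℓa≡1) (sym (value ℓ))) (below m∈ m≢ℓ m≢ℓ′))
      where
      value : ∀ m → unit a 1ℚ · point m ≡ point m a
      value m = dot-coordinate a (point m)

    private
      0<1 : 0ℚ < 1ℚ
      0<1 = from-yes (0ℚ ℚ.<? 1ℚ)

      -1<1 : - 1ℚ < 1ℚ
      -1<1 = from-yes (- 1ℚ ℚ.<? 1ℚ)

    rightLeft-Edge : ∀ gs {g} → Loopless g → g ∈ gs → Edge gs (g , negRight) (g , negLeft)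
    rightLeft-Edge gs {g} loopless g∈ =
      Edge-byCoordinate gs (∈-labels⁺ negRight g∈) (∈-labels⁺ negLeft g∈) (distinct-kinds negRight negLeft loopless λ ())
        (inj₂ g) (point-arc g negRight) (point-arc g negLeft) below
      where
      below : ∀ {m} → m ∈ labels gs → m ≢ (g , negRight) → m ≢ (g , negLeft) → point m (inj₂ g) < 1ℚ
      below {h , ρ} _ _ _ with h ≟ₐ g
      below {h , ρ}        _ _  _  | no h≢g   = subst (_< 1ℚ) (sym (point-offArc h ρ g (h≢g ∘ sym))) 0<1
      below {h , negArc}   _ _  _  | yes refl = subst (_< 1ℚ) (sym (point-arc g negArc)) -1<1
      below {h , negRight} _ ≢R _  | yes refl = contradiction refl ≢R
      below {h , negLeft}  _ _  ≢L | yes refl = contradiction refl ≢L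

    sole-avoids : ∀ {gs} v {g h} → SoleArcAt gs v g → h ∈ gs → h ≢ g → ∀ ρ → point (h , ρ) (inj₁ v) ≡ 0ℚ
    sole-avoids v {h = a , b} sole h∈ h≢g ρ = point-offNode ρ v
      (λ { refl → h≢g (sole h∈ (incident-left a b)) }) (λ { refl → h≢g (sole h∈ (incident-right a b)) })

    leftLeaf-Edge : ∀ gs {i j} → i ≢ j → (i , j) ∈ gs → SoleArcAt gs i (i , j) →
                    Edge gs ((i , j) , negArc) ((i , j) , negRight)
    leftLeaf-Edge gs {i} {j} i≢j g∈ sole =
      Edge-byCoordinate gs (∈-labels⁺ negArc g∈) (∈-labels⁺ negRight g∈) (distinct-kinds negArc negRight i≢j λ ())
        (inj₁ i) (point-left negArc i≢j) (point-left negRight i≢j) below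
      where
      below : ∀ {m} → m ∈ labels gs → m ≢ ((i , j) , negArc) → m ≢ ((i , j) , negRight) → point m (inj₁ i) < 1ℚ
      below {h , ρ} m∈ _ _ with h ≟ₐ (i , j)
      below {h , ρ}        m∈ _  _  | no h≢g   = subst (_< 1ℚ) (sym (sole-avoids i sole (∈-labels⁻ gs m∈) h≢g ρ)) 0<1
      below {h , negLeft}  _  _  _  | yes refl = subst (_< 1ℚ) (sym (point-left negLeft i≢j)) -1<1
      below {h , negArc}   _  ≢A _  | yes refl = contradiction refl ≢A
      below {h , negRight} _  _  ≢R | yes refl = contradiction refl ≢R

    rightLeaf-Edge : ∀ gs {i j} → i ≢ j → (i , j) ∈ gs → SoleArcAt gs j (i , j) →
                     Edge gs ((i , j) , negArc) ((i , j) , negLeft)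
    rightLeaf-Edge gs {i} {j} i≢j g∈ sole =
      Edge-byCoordinate gs (∈-labels⁺ negArc g∈) (∈-labels⁺ negLeft g∈) (distinct-kinds negArc negLeft i≢j λ ())
        (inj₁ j) (point-right negArc i≢j) (point-right negLeft i≢j) below
      where
      below : ∀ {m} → m ∈ labels gs → m ≢ ((i , j) , negArc) → m ≢ ((i , j) , negLeft) → point m (inj₁ j) < 1ℚ
      below {h , ρ} m∈ _ _ with h ≟ₐ (i , j)
      below {h , ρ}        m∈ _  _  | no h≢g   = subst (_< 1ℚ) (sym (sole-avoids j sole (∈-labels⁻ gs m∈) h≢g ρ)) 0<1
      below {h , negRight} _  _  _  | yes refl = subst (_< 1ℚ) (sym (point-right negRight i≢j)) -1<1
      below {h , negArc}   _  ≢A _  | yes refl = contradiction refl ≢A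
      below {h , negLeft}  _  _  ≢L | yes refl = contradiction refl ≢L

module CosmologicalEdges where

  open import Defs
  open Counting
  open Polytopes
  open Graphs
  open CosmologicalPoints
  open import Function using (_∘_; _$_)
  open import Data.Bool using (Bool; true; false; if_then_else_)
  open import Data.Fin using (Fin) renaming (_<_ to _<ᶠ_)
  open import Data.Fin.Properties using (_≟_; <⇒≢)
  open import Data.Integer using (+_)
  open import Data.List using (List; []; _∷_)
  open import Data.List.Membership.Propositional using (_∈_)
  open import Data.List.Membership.Propositional.Properties using (∈-map⁺)
  open import Data.List.Relation.Unary.All as All using (All; all?)
  open import Data.List.Relation.Unary.Any using (here; there)
  open import Data.List.Relation.Unary.Unique.Propositional using (Unique)
  open import Data.Nat using (ℕ)
  open import Data.Product using (Σ-syntax; _×_; _,_; proj₁; proj₂)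
  open import Data.Rational using (ℚ; 0ℚ; 1ℚ; _+_; _*_; _-_; -_; _<_; _/_)
  open import Data.Rational.Properties as ℚ using ()
  open import Data.List.Membership.DecPropositional ℚ._≟_ using (_∈?_)
  open import Data.Rational.Solver using (module +-*-Solver)
  open import Data.Sum using (_⊎_; inj₁; inj₂)
  open import Relation.Nullary using (¬_; contradiction; Dec; yes; no; ⌊_⌋)
  open import Relation.Nullary.Decidable using (from-yes; _×-dec_; _⊎-dec_; _→-dec_)
  open import Relation.Binary.PropositionalEquality using (_≡_; _≢_; refl; sym; trans; cong; cong₂; subst; subst₂)
  open +-*-Solver using (solve; _:=_; _:+_; _:*_; con)

  value : Kind → ℚ → ℚ → ℚ → ℚ
  value ρ a b t = a * coefˡ ρ + b * coefʳ ρ + t * coefᵃ ρ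

  ten : ℚ
  ten = + 10 / 1

  level : Kind → ℚ → ℚ → ℚ
  level negArc   a b = a + b - ten
  level negRight a b = ten - a + b
  level negLeft  a b = ten + a - b

  kinds : List Kind
  kinds = negArc ∷ negRight ∷ negLeft ∷ []

  ∈-kinds : ∀ κ → κ ∈ kinds
  ∈-kinds negArc   = here refl
  ∈-kinds negRight = there (here refl)
  ∈-kinds negLeft  = there (there (here refl))

  Wins : Kind → ℚ → ℚ → Set
  Wins τ a b = value τ a b (level τ a b) ≡ ten × All (λ ρ → ρ ≡ τ ⊎ value ρ a b (level τ a b) < ten) kinds

  wins? : ∀ τ a b → Dec (Wins τ a b)
  wins? τ a b = value τ a b (level τ a b) ℚ.≟ ten ×-dec
                all? (λ ρ → ρ ≟ₖ τ ⊎-dec value ρ a b (level τ a b) ℚ.<? ten) kinds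

  shiftˡ shiftʳ : Kind → ℚ
  shiftˡ negArc   = 0ℚ
  shiftˡ negRight = 1ℚ
  shiftˡ negLeft  = - 1ℚ
  shiftʳ negArc   = 0ℚ
  shiftʳ negRight = - 1ℚ
  shiftʳ negLeft  = 1ℚ

  small medium : List ℚ
  small  = - 1ℚ ∷ 0ℚ ∷ 1ℚ ∷ []
  medium = - (+ 2 / 1) ∷ - 1ℚ ∷ 0ℚ ∷ 1ℚ ∷ + 2 / 1 ∷ []

  shiftˡ-small : ∀ κ → shiftˡ κ ∈ small
  shiftˡ-small negArc   = there (here refl)
  shiftˡ-small negRight = there (there (here refl))
  shiftˡ-small negLeft  = here refl

  shiftʳ-small : ∀ κ → shiftʳ κ ∈ small
  shiftʳ-small negArc   = there (here refl)
  shiftʳ-small negRight = here refl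
  shiftʳ-small negLeft  = there (there (here refl))

  winning-table : All (λ τ → All (λ p → All (λ q → p ≡ 0ℚ ⊎ q ≡ 0ℚ → Wins τ (shiftˡ τ + p) (shiftʳ τ + q))
                                            small) small) kinds
  winning-table = from-yes (all? (λ τ → all? (λ p → all? (λ q →
    (p ℚ.≟ 0ℚ ⊎-dec q ℚ.≟ 0ℚ) →-dec wins? τ (shiftˡ τ + p) (shiftʳ τ + q)) small) small) kinds)

  losing-table : All (λ ρ → All (λ a → All (λ b → value ρ a b 0ℚ < ten) medium) medium) kinds
  losing-table = from-yes (all? (λ ρ → all? (λ a → all? (λ b → value ρ a b 0ℚ ℚ.<? ten) medium) medium) kinds)

  sum-table : All (λ a → All (λ b → a + b ∈ medium) small) small
  sum-table = from-yes (all? (λ a → all? (λ b → a + b ∈? medium) small) small)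

  module _ {n : ℕ} where

    dot-point : ∀ (c : Coord n → ℚ) i j ρ → c · point ((i , j) , ρ) ≡ value ρ (c (inj₁ i)) (c (inj₁ j)) (c (inj₂ (i , j)))
    dot-point c i j ρ = dot-vec c (coefˡ ρ) (coefʳ ρ) (coefᵃ ρ) i j

    shift : Label n → Fin n → ℚ
    shift ((i , j) , κ) v = if ⌊ v ≟ i ⌋ then shiftˡ κ else if ⌊ v ≟ j ⌋ then shiftʳ κ else 0ℚ

    shift-left : ∀ i j κ → shift ((i , j) , κ) i ≡ shiftˡ κ
    shift-left i j κ rewrite ⌊≟⌋-refl _≟_ i = refl

    shift-right : ∀ {i j} κ → i ≢ j → shift ((i , j) , κ) j ≡ shiftʳ κ
    shift-right {i} {j} κ i≢j rewrite ⌊≟⌋-≢ _≟_ (i≢j ∘ sym) | ⌊≟⌋-refl _≟_ j = refl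

    shift-off : ∀ {i j} κ v → v ≢ i → v ≢ j → shift ((i , j) , κ) v ≡ 0ℚ
    shift-off κ v v≢i v≢j rewrite ⌊≟⌋-≢ _≟_ v≢i | ⌊≟⌋-≢ _≟_ v≢j = refl

    shift-small : ∀ ℓ v → shift ℓ v ∈ small
    shift-small ((i , j) , κ) v with ⌊ v ≟ i ⌋ | ⌊ v ≟ j ⌋
    ... | true  | _     = shiftˡ-small κ
    ... | false | true  = shiftʳ-small κ
    ... | false | false = there (here refl)

    ownArc-wins : ∀ {i j k l} τ σ → i <ᶠ j → k <ᶠ l → (i , j) ≢ (k , l) →
      Wins τ (shift ((i , j) , τ) i + shift ((k , l) , σ) i) (shift ((i , j) , τ) j + shift ((k , l) , σ) j)
    ownArc-wins {i} {j} {k} {l} τ σ i<j k<l g≢h =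
      subst₂ (Wins τ) (cong (_+ p) (sym (shift-left i j τ))) (cong (_+ q) (sym (shift-right τ (<⇒≢ i<j))))
        (All.lookup (All.lookup (All.lookup winning-table (∈-kinds τ)) (shift-small m i)) (shift-small m j)
          one-vanishes)
      where
      m : Label n
      m = ((k , l) , σ)
      p q : ℚ
      p = shift m i
      q = shift m j
      one-vanishes : p ≡ 0ℚ ⊎ q ≡ 0ℚ
      one-vanishes with distinct-ordered-arcs i<j k<l g≢h
      ... | inj₁ (i≢k , i≢l) = inj₁ (shift-off σ i i≢k i≢l)
      ... | inj₂ (j≢k , j≢l) = inj₂ (shift-off σ j j≢k j≢l)

    -- The node weights x make each of ℓ, ℓ′ the strict winner on its own arc once that arc is weighted by
    -- `level`, with value ten; all node weights lie in [-2, 2], so every point of another arc stays below ten.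
    module Separator {i j k l : Fin n} (τ σ : Kind) (i<j : i <ᶠ j) (k<l : k <ᶠ l) (g≢h : (i , j) ≢ (k , l)) where

      ℓ ℓ′ : Label n
      ℓ = ((i , j) , τ)
      ℓ′ = ((k , l) , σ)

      x : Fin n → ℚ
      x v = shift ℓ v + shift ℓ′ v

      c : Coord n → ℚ
      c (inj₁ v) = x v
      c (inj₂ h) = if ⌊ h ≟ₐ (i , j) ⌋ then level τ (x i) (x j)
                   else if ⌊ h ≟ₐ (k , l) ⌋ then level σ (x k) (x l) else 0ℚ

      c-g : c (inj₂ (i , j)) ≡ level τ (x i) (x j)
      c-g rewrite ⌊≟⌋-refl _≟ₐ_ (i , j) = refl

      c-h : c (inj₂ (k , l)) ≡ level σ (x k) (x l)
      c-h rewrite ⌊≟⌋-≢ _≟ₐ_ (g≢h ∘ sym) | ⌊≟⌋-refl _≟ₐ_ (k , l) = refl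

      c-elsewhere : ∀ {h} → h ≢ (i , j) → h ≢ (k , l) → c (inj₂ h) ≡ 0ℚ
      c-elsewhere h≢g h≢h′ rewrite ⌊≟⌋-≢ _≟ₐ_ h≢g | ⌊≟⌋-≢ _≟ₐ_ h≢h′ = refl

      onArc : ∀ {a b t} ρ → c (inj₂ (a , b)) ≡ t → c · point ((a , b) , ρ) ≡ value ρ (x a) (x b) t
      onArc {a} {b} ρ eq = trans (dot-point c a b ρ) (cong (value ρ (x a) (x b)) eq)

      wins : Wins τ (x i) (x j)
      wins = ownArc-wins τ σ i<j k<l g≢h

      wins′ : Wins σ (x k) (x l)
      wins′ = subst₂ (Wins σ) (ℚ.+-comm (shift ℓ′ k) (shift ℓ k)) (ℚ.+-comm (shift ℓ′ l) (shift ℓ l))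
                     (ownArc-wins σ τ k<l i<j (g≢h ∘ sym))

      top : c · point ℓ ≡ ten
      top = trans (onArc τ c-g) (proj₁ wins)

      top′ : c · point ℓ′ ≡ ten
      top′ = trans (onArc σ c-h) (proj₁ wins′)

      loses : ∀ {κ a b} ρ → Wins κ a b → ρ ≢ κ → value ρ a b (level κ a b) < ten
      loses ρ (_ , others) ρ≢κ with All.lookup others (∈-kinds ρ)
      ... | inj₁ ρ≡κ  = contradiction ρ≡κ ρ≢κ
      ... | inj₂ <ten = <ten

      medium-weight : ∀ v → x v ∈ medium
      medium-weight v = All.lookup (All.lookup sum-table (shift-small ℓ v)) (shift-small ℓ′ v)

      below : ∀ {a b} ρ → ((a , b) , ρ) ≢ ℓ → ((a , b) , ρ) ≢ ℓ′ → c · point ((a , b) , ρ) < ten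
      below {a} {b} ρ m≢ℓ m≢ℓ′ with (a , b) ≟ₐ (i , j) | (a , b) ≟ₐ (k , l)
      ... | yes refl | _        =
        subst (_< ten) (sym (onArc ρ c-g)) (loses {τ} {x i} {x j} ρ wins (m≢ℓ ∘ cong ((a , b) ,_)))
      ... | no _     | yes refl =
        subst (_< ten) (sym (onArc ρ c-h)) (loses {σ} {x k} {x l} ρ wins′ (m≢ℓ′ ∘ cong ((a , b) ,_)))
      ... | no ≢g    | no ≢h    = subst (_< ten) (sym (onArc ρ (c-elsewhere ≢g ≢h)))
        (All.lookup (All.lookup (All.lookup losing-table (∈-kinds ρ)) (medium-weight a)) (medium-weight b))

    distinctArcs-Edge : ∀ gs {i j k l} τ σ → i <ᶠ j → k <ᶠ l → (i , j) ≢ (k , l) →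
      ((i , j) , τ) ∈ labels gs → ((k , l) , σ) ∈ labels gs → Edge gs ((i , j) , τ) ((k , l) , σ)
    distinctArcs-Edge gs {i} {j} {k} {l} τ σ i<j k<l g≢h ℓ∈ ℓ′∈ =
      Edge-byFunctional gs ℓ∈ ℓ′∈ (g≢h ∘ cong proj₁ ∘ point-injective {g = i , j} {τ} {k , l} {σ} (<⇒≢ i<j))
        c (trans top (sym top′))
        λ { {(a , b) , ρ} _ m≢ℓ m≢ℓ′ → subst (c · point ((a , b) , ρ) <_) (sym top) (below ρ m≢ℓ m≢ℓ′) }
      where
      open Separator τ σ i<j k<l g≢h

    sameArcRule : List (Arc n) → Arc n → Kind → Kind → Bool
    sameArcRule gs (i , j) negArc   negRight = isLeaf gs i
    sameArcRule gs (i , j) negRight negArc   = isLeaf gs i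
    sameArcRule gs (i , j) negArc   negLeft  = isLeaf gs j
    sameArcRule gs (i , j) negLeft  negArc   = isLeaf gs j
    sameArcRule gs g       _        _        = true

    edgeRule : List (Arc n) → Label n × Label n → Bool
    edgeRule gs ((g , κ) , (h , σ)) = if ⌊ g ≟ₐ h ⌋ then sameArcRule gs g κ σ else true

    MidpointAtNode : Fin n → Label n → Label n → Set
    MidpointAtNode v ℓ m = ∀ c → c · point ℓ + c · point m ≡ c (inj₁ v) + c (inj₁ v)

    private
      midpoint-left : ∀ (a b : Fin n) → MidpointAtNode a ((a , b) , negArc) ((a , b) , negRight)
      midpoint-left a b c = trans (cong₂ _+_ (dot-point c a b negArc) (dot-point c a b negRight)) $
        solve 3 (λ x y z → (x :* con 1ℚ :+ y :* con 1ℚ :+ z :* con (- 1ℚ)) :+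
                           (x :* con 1ℚ :+ y :* con (- 1ℚ) :+ z :* con 1ℚ) := x :+ x)
                refl (c (inj₁ a)) (c (inj₁ b)) (c (inj₂ (a , b)))

      midpoint-right : ∀ (a b : Fin n) → MidpointAtNode b ((a , b) , negArc) ((a , b) , negLeft)
      midpoint-right a b c = trans (cong₂ _+_ (dot-point c a b negArc) (dot-point c a b negLeft)) $
        solve 3 (λ x y z → (x :* con 1ℚ :+ y :* con 1ℚ :+ z :* con (- 1ℚ)) :+
                           (x :* con (- 1ℚ) :+ y :* con 1ℚ :+ z :* con 1ℚ) := y :+ y)
                refl (c (inj₁ a)) (c (inj₁ b)) (c (inj₂ (a , b)))

    midpoint-at : ∀ {v} h → incident v h ≡ true → Σ[ κ ∈ Kind ] MidpointAtNode v (h , negArc) (h , κ)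
    midpoint-at {v} (a , b) vh with v ≟ a | v ≟ b
    ... | yes refl | _        = negRight , midpoint-left a b
    ... | no _     | yes refl = negLeft , midpoint-right a b
    ... | no _     | no _     = contradiction vh λ ()

    sharedNode-¬Edge : ∀ gs {g} κ {v h} → MidpointAtNode v (g , negArc) (g , κ) →
                       h ∈ gs → incident v h ≡ true → h ≢ g → ¬ Edge gs (g , negArc) (g , κ)
    sharedNode-¬Edge gs {g} κ {v} {h} mid h∈ vh h≢g with midpoint-at h vh
    ... | σ , mid′ =
      sharedMidpoint⇒¬IsEdge (coords n) (∈-map⁺ point (∈-labels⁺ negArc h∈)) (∈-map⁺ point (∈-labels⁺ σ h∈))
        (λ c → trans (mid′ c) (sym (mid c))) (inj₂ h) (point-offArc g negArc h h≢g) (point-offArc g κ h h≢g)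
        (λ eq → -1≢0 (trans (sym (point-arc h negArc)) eq))
      where
      -1≢0 : - 1ℚ ≢ 0ℚ
      -1≢0 ()

    Edge⇒edgeRule : ∀ gs → Unique gs → ∀ {ℓ ℓ′} → ℓ ∈ labels gs → Edge gs ℓ ℓ′ → edgeRule gs (ℓ , ℓ′) ≡ true
    Edge⇒edgeRule gs u {(i , j) , κ} {h , σ} ℓ∈ edge with (i , j) ≟ₐ h
    ... | no _     = refl
    ... | yes refl = sameArc κ σ edge
      where
      g∈ : (i , j) ∈ gs
      g∈ = ∈-labels⁻ gs ℓ∈
      needsLeaf : ∀ v κ → incident v (i , j) ≡ true → MidpointAtNode v ((i , j) , negArc) ((i , j) , κ) →
                  Edge gs ((i , j) , negArc) ((i , j) , κ) → isLeaf gs v ≡ true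
      needsLeaf v κ vg mid e with isLeaf gs v in leaf
      ... | true  = refl
      ... | false = let (h , h∈ , vh , h≢g) = ¬isLeaf⇒another v u g∈ vg leaf
                    in contradiction e (sharedNode-¬Edge gs κ mid h∈ vh h≢g)
      sameArc : ∀ κ σ → Edge gs ((i , j) , κ) ((i , j) , σ) → sameArcRule gs (i , j) κ σ ≡ true
      sameArc negArc   negRight e = needsLeaf i negRight (incident-left i j) (midpoint-left i j) e
      sameArc negRight negArc   e = needsLeaf i negRight (incident-left i j) (midpoint-left i j) (IsEdge-sym (coords n) e)
      sameArc negArc   negLeft  e = needsLeaf j negLeft (incident-right i j) (midpoint-right i j) e
      sameArc negLeft  negArc   e = needsLeaf j negLeft (incident-right i j) (midpoint-right i j) (IsEdge-sym (coords n) e)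
      sameArc negArc   negArc   _ = refl
      sameArc negRight negRight _ = refl
      sameArc negRight negLeft  _ = refl
      sameArc negLeft  negRight _ = refl
      sameArc negLeft  negLeft  _ = refl

    edgeRule⇒Edge : ∀ gs → (∀ {g} → g ∈ gs → proj₁ g <ᶠ proj₂ g) → ∀ {ℓ ℓ′} → ℓ ∈ labels gs → ℓ′ ∈ labels gs →
                    ℓ ≢ ℓ′ → edgeRule gs (ℓ , ℓ′) ≡ true → Edge gs ℓ ℓ′
    edgeRule⇒Edge gs ordered {(i , j) , κ} {(k , l) , σ} ℓ∈ ℓ′∈ ℓ≢ℓ′ rule with (i , j) ≟ₐ (k , l)
    ... | no g≢h   = distinctArcs-Edge gs κ σ (ordered (∈-labels⁻ gs ℓ∈)) (ordered (∈-labels⁻ gs ℓ′∈)) g≢h ℓ∈ ℓ′∈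
    ... | yes refl = sameArc κ σ (ℓ≢ℓ′ ∘ cong ((i , j) ,_)) rule
      where
      g∈ : (i , j) ∈ gs
      g∈ = ∈-labels⁻ gs ℓ∈
      i≢j : i ≢ j
      i≢j = <⇒≢ (ordered g∈)
      leftLeaf : isLeaf gs i ≡ true → Edge gs ((i , j) , negArc) ((i , j) , negRight)
      leftLeaf leaf = leftLeaf-Edge gs i≢j g∈ (isLeaf⇒sole i leaf g∈ (incident-left i j))
      rightLeaf : isLeaf gs j ≡ true → Edge gs ((i , j) , negArc) ((i , j) , negLeft)
      rightLeaf leaf = rightLeaf-Edge gs i≢j g∈ (isLeaf⇒sole j leaf g∈ (incident-right i j))
      sameArc : ∀ κ σ → κ ≢ σ → sameArcRule gs (i , j) κ σ ≡ true → Edge gs ((i , j) , κ) ((i , j) , σ)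
      sameArc negArc   negRight _ leaf = leftLeaf leaf
      sameArc negRight negArc   _ leaf = IsEdge-sym (coords n) (leftLeaf leaf)
      sameArc negArc   negLeft  _ leaf = rightLeaf leaf
      sameArc negLeft  negArc   _ leaf = IsEdge-sym (coords n) (rightLeaf leaf)
      sameArc negRight negLeft  _ _    = rightLeft-Edge gs i≢j g∈
      sameArc negLeft  negRight _ _    = IsEdge-sym (coords n) (rightLeft-Edge gs i≢j g∈)
      sameArc negArc   negArc   κ≢κ _  = contradiction refl κ≢κ
      sameArc negRight negRight κ≢κ _  = contradiction refl κ≢κ
      sameArc negLeft  negLeft  κ≢κ _  = contradiction refl κ≢κ

module EdgeFormula where

  open import Defs
  open Counting
  open Polytopes
  open Graphs
  open CosmologicalPoints
  open CosmologicalEdges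
  open import Function using (_∘_)
  import Data.Nat.Properties as ℕ
  open import Algebra.Properties.Semiring.Sum ℕ.+-*-semiring using (sum-syntax; sum-cong-≗)
  open import Data.Bool using (Bool; true)
  open import Data.Fin using (Fin) renaming (_<_ to _<ᶠ_)
  open import Data.Fin.Properties using (<⇒≢)
  open import Data.List using (List; []; _∷_; _++_; map; length; filterᵇ)
  open import Data.List.Properties using (length-map)
  open import Data.List.Membership.Propositional using (_∈_; _∉_)
  open import Data.List.Membership.Propositional.Properties using (∈-map⁺; ∈-map⁻)
  open import Data.List.Relation.Unary.All as All using (All)
  import Data.List.Relation.Unary.All.Properties as All
  import Data.List.Relation.Unary.AllPairs.Properties as AllPairs
  open import Data.List.Relation.Unary.Unique.Propositional using (Unique; _∷_)
  open import Data.Nat using (ℕ; suc; _+_; _*_)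
  open import Data.Nat.Combinatorics using (_C_; nC1≡n; nCk+nC[k+1]≡[n+1]C[k+1])
  open import Data.Nat.ListAction using (sum)
  open import Data.Nat.Tactic.RingSolver using (solve-∀)
  open import Data.Product using (Σ-syntax; _×_; _,_; proj₁; proj₂)
  open import Data.Rational using (ℚ)
  open import Data.Sum using (inj₁; inj₂)
  open import Relation.Binary.PropositionalEquality using (_≡_; refl; sym; trans; cong; cong₂; subst; module ≡-Reasoning)

  suc-C₂ : ∀ m → suc m C 2 ≡ m + m C 2
  suc-C₂ m = trans (sym (nCk+nC[k+1]≡[n+1]C[k+1] m 1)) (cong (_+ m C 2) (nC1≡n m))

  module _ {n : ℕ} where

    edgeLabels : List (Arc n) → List (Label n × Label n)
    edgeLabels gs = filterᵇ (edgeRule gs) (pairsOf (labels gs))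

    leafEnds : List (Arc n) → Arc n → ℕ
    leafEnds gs (i , j) = 𝟙 (isLeaf gs i) + 𝟙 (isLeaf gs j)

    length-labels : ∀ (gs : List (Arc n)) → length (labels gs) ≡ 3 * length gs
    length-labels []       = refl
    length-labels (g ∷ gs) = trans (cong (3 +_) (length-labels gs)) (sym (ℕ.*-suc 3 (length gs)))

    module _ (full : List (Arc n)) where

      private
        rule : Label n × Label n → Bool
        rule = edgeRule full

      edgeRule-sameArc : ∀ g κ σ → rule ((g , κ) , (g , σ)) ≡ sameArcRule full g κ σ
      edgeRule-sameArc g κ σ rewrite ⌊≟⌋-refl _≟ₐ_ g = refl

      count-crossing : ∀ g κ rest → g ∉ rest → count (rule ∘ ((g , κ) ,_)) (labels rest) ≡ 3 * length rest
      count-crossing g κ rest g∉ =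
        trans (count-all (rule ∘ ((g , κ) ,_)) (labels rest) other-arc) (length-labels rest)
        where
        other-arc : ∀ {m} → m ∈ labels rest → rule ((g , κ) , m) ≡ true
        other-arc {h , σ} m∈ rewrite ⌊≟⌋-≢ _≟ₐ_ {g} {h} (λ { refl → g∉ (∈-labels⁻ rest m∈) }) = refl

      count-step : ∀ g rest → g ∉ rest →
        count rule (pairsOf (labels (g ∷ rest))) ≡
        3 * (3 * length rest) + (1 + leafEnds full g) + count rule (pairsOf (labels rest))
      count-step g rest g∉ = begin
        count rule (map (A ,_) (R ∷ L ∷ ls) ++ (map (R ,_) (L ∷ ls) ++ (map (L ,_) ls ++ pairsOf ls)))
          ≡⟨ count-++ rule (map (A ,_) (R ∷ L ∷ ls)) _ ⟩
        count rule (map (A ,_) (R ∷ L ∷ ls)) + count rule (map (R ,_) (L ∷ ls) ++ (map (L ,_) ls ++ pairsOf ls))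
          ≡⟨ cong (count rule (map (A ,_) (R ∷ L ∷ ls)) +_)
               (trans (count-++ rule (map (R ,_) (L ∷ ls)) _) (cong (count rule (map (R ,_) (L ∷ ls)) +_)
                 (count-++ rule (map (L ,_) ls) _))) ⟩
        (𝟙 (rule (A , R)) + (𝟙 (rule (A , L)) + count rule (map (A ,_) ls))) +
          ((𝟙 (rule (R , L)) + count rule (map (R ,_) ls)) + (count rule (map (L ,_) ls) + count rule (pairsOf ls)))
          ≡⟨ cong₂ _+_ (cong₂ _+_ (cong 𝟙 (edgeRule-sameArc g negArc negRight))
                         (cong₂ _+_ (cong 𝟙 (edgeRule-sameArc g negArc negLeft)) (crossing negArc)))
                       (cong₂ _+_ (cong₂ _+_ (cong 𝟙 (edgeRule-sameArc g negRight negLeft)) (crossing negRight))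
                         (cong (_+ count rule (pairsOf ls)) (crossing negLeft))) ⟩
        (𝟙 (isLeaf full (proj₁ g)) + (𝟙 (isLeaf full (proj₂ g)) + r)) + ((1 + r) + (r + count rule (pairsOf ls)))
          ≡⟨ regroup (𝟙 (isLeaf full (proj₁ g))) (𝟙 (isLeaf full (proj₂ g))) (length rest) (count rule (pairsOf ls)) ⟩
        3 * (3 * length rest) + (1 + leafEnds full g) + count rule (pairsOf ls) ∎
        where
        open ≡-Reasoning
        A R L : Label n
        A = (g , negArc)
        R = (g , negRight)
        L = (g , negLeft)
        ls : List (Label n)
        ls = labels rest
        r : ℕ
        r = 3 * length rest
        crossing : ∀ κ → count rule (map ((g , κ) ,_) ls) ≡ r
        crossing κ = trans (count-map rule ((g , κ) ,_) ls) (count-crossing g κ rest g∉)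
        regroup : ∀ a b m c → (a + (b + 3 * m)) + ((1 + 3 * m) + (3 * m + c)) ≡ 3 * (3 * m) + (1 + (a + b)) + c
        regroup = solve-∀

      count-edgeLabels : ∀ gs → Unique gs →
        count rule (pairsOf (labels gs)) ≡ 9 * (length gs C 2) + length gs + sum (map (leafEnds full) gs)
      count-edgeLabels []       _          = refl
      count-edgeLabels (g ∷ gs) (g∉ ∷ u) = begin
        count rule (pairsOf (labels (g ∷ gs)))
          ≡⟨ count-step g gs g∉gs ⟩
        3 * (3 * m) + (1 + e) + count rule (pairsOf (labels gs))
          ≡⟨ cong (3 * (3 * m) + (1 + e) +_) (count-edgeLabels gs u) ⟩
        3 * (3 * m) + (1 + e) + (9 * (m C 2) + m + s)
          ≡⟨ regroup m (m C 2) e s ⟩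
        9 * (m + m C 2) + suc m + (e + s)
          ≡⟨ cong (λ c → 9 * c + suc m + (e + s)) (sym (suc-C₂ m)) ⟩
        9 * (suc m C 2) + suc m + (e + s) ∎
        where
        open ≡-Reasoning
        g∉gs : g ∉ gs
        g∉gs g∈ = All.lookup g∉ g∈ refl
        m e s : ℕ
        m = length gs
        e = leafEnds full g
        s = sum (map (leafEnds full) gs)
        regroup : ∀ m c e s → 3 * (3 * m) + (1 + e) + (9 * c + m + s) ≡ 9 * (m + c) + suc m + (e + s)
        regroup = solve-∀

  module _ {n : ℕ} where

    edgeFormula : ℕ → (Fin n → ℕ) → ℕ
    edgeFormula m d = 9 * (m C 2) + m + ∑[ v < n ] 𝟙 (isOne (d v))

    cosmoEdges : List (Arc n) → ℕ
    cosmoEdges gs = edgeFormula (length gs) (degree gs)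

    sum-leafEnds : ∀ {gs} → All Loopless gs → sum (map (leafEnds gs) gs) ≡ ∑[ v < n ] 𝟙 (isLeaf gs v)
    sum-leafEnds {gs} loopless =
      trans (double-counting (𝟙 ∘ isLeaf gs) loopless) (sum-cong-≗ (λ v → leaf*degree (degree gs v)))
      where
      leaf*degree : ∀ d → 𝟙 (isOne d) * d ≡ 𝟙 (isOne d)
      leaf*degree 0             = refl
      leaf*degree 1             = refl
      leaf*degree (suc (suc d)) = refl

    length-edgeLabels : ∀ {gs} → Unique gs → All Loopless gs → length (edgeLabels gs) ≡ cosmoEdges gs
    length-edgeLabels {gs} u loopless = trans (length-filterᵇ (edgeRule gs) (pairsOf (labels gs)))
      (trans (count-edgeLabels gs gs u) (cong (9 * (length gs C 2) + length gs +_) (sum-leafEnds loopless)))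

    cosmo-EdgeCount : ∀ gs → Unique gs → (∀ {g} → g ∈ gs → proj₁ g <ᶠ proj₂ g) →
                      EdgeCount (coords n) (Points gs) (cosmoEdges gs)
    cosmo-EdgeCount gs u ordered =
      map pointPair (edgeLabels gs) ,
      trans (length-map pointPair (edgeLabels gs)) (length-edgeLabels u loopless) ,
      All.map⁺ (All.tabulate listed-Edge) ,
      AllPairs.map⁺ (AllPairs.filter⁺ _ (pairsOf-unique (labels-distinct u loopless))) ,
      complete
      where
      pointPair : Label n × Label n → (Coord n → ℚ) × (Coord n → ℚ)
      pointPair (ℓ , ℓ′) = point ℓ , point ℓ′

      loopless : All Loopless gs
      loopless = All.tabulate (<⇒≢ ∘ ordered)

      listed-Edge : ∀ {p} → p ∈ edgeLabels gs → Edge gs (proj₁ p) (proj₂ p)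
      listed-Edge p∈ =
        let (p∈pairs , follows) = ∈-filterᵇ⁻ (edgeRule gs) p∈
            (ℓ∈ , ℓ′∈) = ∈-pairsOf⁻ (labels gs) p∈pairs
        in edgeRule⇒Edge gs ordered ℓ∈ ℓ′∈ (pairsOf-distinct (labels-unique u) p∈pairs) follows

      complete : ∀ x y → IsEdge (coords n) (Points gs) x y →
                 Σ[ q ∈ _ ] (q ∈ map pointPair (edgeLabels gs) × SamePair (coords n) (x , y) q)
      complete x y edge@(x∈ , y∈ , x≉y , _) with ∈-map⁻ point x∈ | ∈-map⁻ point y∈
      ... | ℓ , ℓ∈ , refl | ℓ′ , ℓ′∈ , refl with ∈-pairsOf⁺ (labels gs) ℓ∈ ℓ′∈ (λ { refl → x≉y λ _ → refl })
      ...   | inj₁ ℓℓ′∈ = pointPair (ℓ , ℓ′) ,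
                ∈-map⁺ pointPair (∈-filterᵇ⁺ (edgeRule gs) ℓℓ′∈ (Edge⇒edgeRule gs u ℓ∈ edge)) ,
                inj₁ ((λ _ → refl) , (λ _ → refl))
      ...   | inj₂ ℓ′ℓ∈ = pointPair (ℓ′ , ℓ) ,
                ∈-map⁺ pointPair (∈-filterᵇ⁺ (edgeRule gs) ℓ′ℓ∈ (Edge⇒edgeRule gs u ℓ′∈ (IsEdge-sym (coords n) edge))) ,
                inj₂ ((λ _ → refl) , (λ _ → refl))

  F1⇒≡cosmoEdges : ∀ {n} (X : Config n) {k} → F1 X k → k ≡ cosmoEdges (arcs X)
  F1⇒≡cosmoEdges {n} X f₁≡k =
    EdgeCount-unique (coords n) (subst (λ S → EdgeCount (coords n) S _) (cosmoPts≡Points X) f₁≡k)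
                                (cosmo-EdgeCount (arcs X) (arcs-unique X) (arcs-ordered X))

module SecondDifference where

  open import Defs
  open Counting
  open Graphs
  open EdgeFormula
  open import Function using (_∘_)
  import Data.Nat.Properties as ℕ
  open import Algebra.Properties.Semiring.Sum ℕ.+-*-semiring
    using (sum-syntax; sum-cong-≗; ∑-distrib-+; *-distribˡ-sum)
  open import Data.Bool using (Bool; true; false)
  open import Data.Fin using (Fin) renaming (_<_ to _<ᶠ_)
  open import Data.Fin.Properties using (_≟_; <⇒≢)
  open import Data.List using (length)
  open import Data.Integer using (ℤ; +_; _-_; ∣_∣; _⊖_) renaming (_+_ to _+ℤ_)
  import Data.Integer.Properties as ℤ
  import Data.Integer.Tactic.RingSolver as ℤ-Solver
  open import Data.Nat using (ℕ; suc; _+_; _*_; _≤_; z≤n; s≤s)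
  open import Data.Nat.Combinatorics using (_C_)
  open import Data.Nat.Tactic.RingSolver using (solve-∀)
  open import Data.Product using (_,_)
  open import Data.Sum using (inj₁; inj₂)
  open import Relation.Nullary using (yes; no; ⌊_⌋)
  open import Relation.Binary.PropositionalEquality using (_≡_; _≢_; refl; sym; trans; cong; cong₂; subst; subst₂)

  record SecondDifference≤ (bound a b c d : ℕ) : Set where
    constructor square
    field
      upper : a + d ≤ b + c + bound
      lower : b + c ≤ a + d + bound

  SecondDifference≤-resp : ∀ {bound a b c d a′ b′ c′ d′} → a ≡ a′ → b ≡ b′ → c ≡ c′ → d ≡ d′ →
                           SecondDifference≤ bound a b c d → SecondDifference≤ bound a′ b′ c′ d′
  SecondDifference≤-resp refl refl refl refl bounded = bounded

  SecondDifference≤⇒∣∣≤ : ∀ {bound a b c d} → SecondDifference≤ bound a b c d →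
                           ∣ (((+ a) - (+ b)) - (+ c)) +ℤ (+ d) ∣ ≤ bound
  SecondDifference≤⇒∣∣≤ {bound} {a} {b} {c} {d} (square ad≤ bc≤) =
    subst (λ z → ∣ z ∣ ≤ bound) (sym (trans (regroup (+ a) (+ b) (+ c) (+ d)) (ℤ.[+m]-[+n]≡m⊖n (a + d) (b + c)))) ∣⊖∣≤
    where
    regroup : ∀ (a b c d : ℤ) → ((a - b) - c) +ℤ d ≡ (a +ℤ d) - (b +ℤ c)
    regroup = ℤ-Solver.solve-∀
    ∣⊖∣≤ : ∣ (a + d) ⊖ (b + c) ∣ ≤ bound
    ∣⊖∣≤ with ℕ.≤-total (b + c) (a + d)
    ... | inj₁ bc≤ad rewrite ℤ.⊖-≥ bc≤ad = ℕ.m≤n+o⇒m∸n≤o (a + d) (b + c) ad≤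
    ... | inj₂ ad≤bc rewrite ℤ.∣m⊖n∣≡∣n⊖m∣ (a + d) (b + c) | ℤ.⊖-≥ ad≤bc = ℕ.m≤n+o⇒m∸n≤o (b + c) (a + d) bc≤

  SecondDifference≤-+ : ∀ {eA eB eC eD lA lB lC lD} → eA + eD ≡ eB + eC + 9 → SecondDifference≤ 4 lA lB lC lD →
                        SecondDifference≤ 13 (eA + lA) (eB + lB) (eC + lC) (eD + lD)
  SecondDifference≤-+ {eA} {eB} {eC} {eD} {lA} {lB} {lC} {lD} exact (square upper lower) = square upper′ lower′
    where
    open ℕ.≤-Reasoning
    regroup : ∀ e l e′ l′ → e + l + (e′ + l′) ≡ e + e′ + (l + l′)
    regroup = solve-∀
    upper′ : eA + lA + (eD + lD) ≤ eB + lB + (eC + lC) + 13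
    upper′ = begin
      eA + lA + (eD + lD)         ≡⟨ regroup eA lA eD lD ⟩
      eA + eD + (lA + lD)         ≡⟨ cong (_+ (lA + lD)) exact ⟩
      eB + eC + 9 + (lA + lD)     ≤⟨ ℕ.+-monoʳ-≤ (eB + eC + 9) upper ⟩
      eB + eC + 9 + (lB + lC + 4) ≡⟨ shuffle eB eC lB lC ⟩
      eB + lB + (eC + lC) + 13    ∎
      where
      shuffle : ∀ b c l l′ → b + c + 9 + (l + l′ + 4) ≡ b + l + (c + l′) + 13
      shuffle = solve-∀
    lower′ : eB + lB + (eC + lC) ≤ eA + lA + (eD + lD) + 13
    lower′ = begin
      eB + lB + (eC + lC)              ≡⟨ regroup eB lB eC lC ⟩
      eB + eC + (lB + lC)              ≤⟨ ℕ.+-monoʳ-≤ (eB + eC) lower ⟩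
      eB + eC + (lA + lD + 4)          ≤⟨ ℕ.m≤m+n _ 18 ⟩
      eB + eC + (lA + lD + 4) + 18     ≡⟨ shuffle (eB + eC) (lA + lD) ⟩
      eB + eC + 9 + (lA + lD) + 13     ≡⟨ cong (λ s → s + (lA + lD) + 13) (sym exact) ⟩
      eA + eD + (lA + lD) + 13         ≡⟨ cong (_+ 13) (sym (regroup eA lA eD lD)) ⟩
      eA + lA + (eD + lD) + 13         ∎
      where
      shuffle : ∀ s l → s + (l + 4) + 18 ≡ s + 9 + l + 13
      shuffle = solve-∀

  isOne-square : ∀ d x y → x ≤ 1 →
    SecondDifference≤ (2 * x) (𝟙 (isOne (d + x + y))) (𝟙 (isOne (d + x))) (𝟙 (isOne (d + y))) (𝟙 (isOne d))
  isOne-square d 0 y _ rewrite ℕ.+-identityʳ d = square (swap a b) (swap b a)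
    where
    a = 𝟙 (isOne (d + y))
    b = 𝟙 (isOne d)
    swap : ∀ p q → p + q ≤ q + p + 0
    swap p q = ℕ.≤-reflexive (trans (ℕ.+-comm p q) (sym (ℕ.+-identityʳ (q + p))))
  isOne-square d 1 y _ = square (at-most-2 (d + 1 + y) d _) (at-most-2 (d + 1) (d + y) _)
    where
    ≤1 : ∀ p → 𝟙 (isOne p) ≤ 1
    ≤1 0             = z≤n
    ≤1 1             = s≤s z≤n
    ≤1 (suc (suc _)) = z≤n
    at-most-2 : ∀ p q r → 𝟙 (isOne p) + 𝟙 (isOne q) ≤ r + 2
    at-most-2 p q r = ℕ.≤-trans (ℕ.+-mono-≤ (≤1 p) (≤1 q)) (ℕ.m≤n+m 2 r)
  isOne-square d (suc (suc _)) y (s≤s ())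

  binomial-square : ∀ m → (9 * (suc (suc m) C 2) + suc (suc m)) + (9 * (m C 2) + m) ≡
                          (9 * (suc m C 2) + suc m) + (9 * (suc m C 2) + suc m) + 9
  binomial-square m rewrite suc-C₂ (suc m) | suc-C₂ m = arithmetic m (m C 2)
    where
    arithmetic : ∀ m c → 9 * (suc m + (m + c)) + suc (suc m) + (9 * c + m) ≡
                         9 * (m + c) + suc m + (9 * (m + c) + suc m) + 9
    arithmetic = solve-∀

  module _ {n : ℕ} where

    leavesOf : (Fin n → ℕ) → ℕ
    leavesOf d = ∑[ v < n ] 𝟙 (isOne (d v))

    leavesOf-square : ∀ (d x y : Fin n → ℕ) → (∀ v → x v ≤ 1) → ∑[ v < n ] x v ≡ 2 →
      SecondDifference≤ 4 (leavesOf (λ v → d v + x v + y v)) (leavesOf (λ v → d v + x v))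
                          (leavesOf (λ v → d v + y v)) (leavesOf d)
    leavesOf-square d x y x≤1 ∑x≡2 =
      square (sum-bound (SecondDifference≤.upper ∘ pointwise)) (sum-bound (SecondDifference≤.lower ∘ pointwise))
      where
      pointwise : ∀ v → SecondDifference≤ (2 * x v) _ _ _ _
      pointwise v = isOne-square (d v) (x v) (y v) (x≤1 v)
      split : ∀ f g → ∑[ v < n ] (𝟙 (isOne (f v)) + 𝟙 (isOne (g v))) ≡ leavesOf f + leavesOf g
      split f g = ∑-distrib-+ (λ v → 𝟙 (isOne (f v))) (λ v → 𝟙 (isOne (g v)))
      ∑2x≡4 : ∑[ v < n ] (2 * x v) ≡ 4
      ∑2x≡4 = trans (sym (*-distribˡ-sum 2 x)) (cong (2 *_) ∑x≡2)
      sum-bound : ∀ {f g h k} →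
                  (∀ v → 𝟙 (isOne (f v)) + 𝟙 (isOne (g v)) ≤ 𝟙 (isOne (h v)) + 𝟙 (isOne (k v)) + 2 * x v) →
                  leavesOf f + leavesOf g ≤ leavesOf h + leavesOf k + 4
      sum-bound {f} {g} {h} {k} pointwise≤ = subst₂ _≤_ (split f g) (cong₂ _+_ (split h k) ∑2x≡4) (∑-≤-+ pointwise≤)

    edgeFormula-square : ∀ m (d x y : Fin n → ℕ) → (∀ v → x v ≤ 1) → ∑[ v < n ] x v ≡ 2 →
      SecondDifference≤ 13 (edgeFormula (suc (suc m)) (λ v → d v + x v + y v)) (edgeFormula (suc m) (λ v → d v + x v))
                           (edgeFormula (suc m) (λ v → d v + y v)) (edgeFormula m d)
    edgeFormula-square m d x y x≤1 ∑x≡2 = SecondDifference≤-+ (binomial-square m) (leavesOf-square d x y x≤1 ∑x≡2)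

    edgeFormula-cong : ∀ {m m′} (d d′ : Fin n → ℕ) → m ≡ m′ → (∀ v → d v ≡ d′ v) → edgeFormula m d ≡ edgeFormula m′ d′
    edgeFormula-cong {m} _ _ refl d≗d′ =
      cong (λ l → 9 * (m C 2) + m + l) (sum-cong-≗ (λ v → cong (𝟙 ∘ isOne) (d≗d′ v)))

    length-arcs : ∀ (Z : Config n) → length (arcs Z) ≡ count (λ _ → true) (arcs Z)
    length-arcs Z = sym (count-all (λ _ → true) (arcs Z) (λ _ → refl))

    cosmoEdges-cong : ∀ {Z Z′ : Config n} → (∀ a c → Z a c ≡ Z′ a c) → cosmoEdges (arcs Z) ≡ cosmoEdges (arcs Z′)
    cosmoEdges-cong {Z} {Z′} Z≗Z′ = edgeFormula-cong (degree (arcs Z)) (degree (arcs Z′))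
      (trans (length-arcs Z) (trans (count-arcs-cong _ Z≗Z′) (sym (length-arcs Z′))))
      (λ v → count-arcs-cong (incident v) Z≗Z′)

    module Square (X : Config n) {i j k l : Fin n} (i<j : i <ᶠ j) (k<l : k <ᶠ l) (e≢f : (i , j) ≢ (k , l)) where

      Z : Bool → Bool → Config n
      Z b₁ b₂ = set (set X i j b₁) k l b₂

      base : (Arc n → Bool) → ℕ
      base w = count w (arcs (Z false false))

      count-Z10 : ∀ w → count w (arcs (Z true false)) ≡ base w + 𝟙 (w (i , j))
      count-Z10 w = trans (count-arcs-cong w (set-comm X true false e≢f))
        (trans (count-arcs-set (set X k l false) i<j w)
               (cong (_+ 𝟙 (w (i , j))) (count-arcs-cong w λ a c → sym (set-comm X false false e≢f a c))))

      count-Z01 : ∀ w → count w (arcs (Z false true)) ≡ base w + 𝟙 (w (k , l))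
      count-Z01 w = count-arcs-set (set X i j false) k<l w

      count-Z11 : ∀ w → count w (arcs (Z true true)) ≡ base w + 𝟙 (w (i , j)) + 𝟙 (w (k , l))
      count-Z11 w = trans (count-arcs-set (set X i j true) k<l w) (cong (_+ 𝟙 (w (k , l))) (count-Z10 w))

      m : ℕ
      m = base (λ _ → true)

      d x y : Fin n → ℕ
      d v = base (incident v)
      x v = 𝟙 (incident v (i , j))
      y v = 𝟙 (incident v (k , l))

      K : Bool → Bool → ℕ
      K b₁ b₂ = cosmoEdges (arcs (Z b₁ b₂))

      K-via-counts : ∀ b₁ b₂ {m′ d′} → count (λ _ → true) (arcs (Z b₁ b₂)) ≡ m′ →
                     (∀ v → count (incident v) (arcs (Z b₁ b₂)) ≡ d′ v) → K b₁ b₂ ≡ edgeFormula m′ d′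
      K-via-counts b₁ b₂ m≡ d≗ = edgeFormula-cong (degree (arcs (Z b₁ b₂))) _ (trans (length-arcs (Z b₁ b₂)) m≡) d≗

      K11 : K true true ≡ edgeFormula (suc (suc m)) (λ v → d v + x v + y v)
      K11 = K-via-counts true true (trans (count-Z11 _) (+1+1 m)) (count-Z11 ∘ incident)
        where
        +1+1 : ∀ m → m + 1 + 1 ≡ suc (suc m)
        +1+1 = solve-∀

      K10 : K true false ≡ edgeFormula (suc m) (λ v → d v + x v)
      K10 = K-via-counts true false (trans (count-Z10 _) (ℕ.+-comm m 1)) (count-Z10 ∘ incident)

      K01 : K false true ≡ edgeFormula (suc m) (λ v → d v + y v)
      K01 = K-via-counts false true (trans (count-Z01 _) (ℕ.+-comm m 1)) (count-Z01 ∘ incident)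

      K00 : K false false ≡ edgeFormula m d
      K00 = K-via-counts false false refl (λ _ → refl)

      x≤1 : ∀ v → x v ≤ 1
      x≤1 v with incident v (i , j)
      ... | true  = s≤s z≤n
      ... | false = z≤n

      ∑x≡2 : ∑[ v < n ] x v ≡ 2
      ∑x≡2 = trans (sum-cong-≗ (λ v → incident-split v (<⇒≢ i<j)))
        (trans (∑-distrib-+ (λ v → 𝟙 ⌊ v ≟ i ⌋) (λ v → 𝟙 ⌊ v ≟ j ⌋)) (cong₂ _+_ (∑-𝟙≟ i) (∑-𝟙≟ j)))
        where
        ∑-𝟙≟ : ∀ a → ∑[ v < n ] 𝟙 ⌊ v ≟ a ⌋ ≡ 1
        ∑-𝟙≟ a = trans (sum-cong-≗ {x = λ v → 𝟙 ⌊ v ≟ a ⌋} (λ v → sym (ℕ.*-identityˡ _))) (∑-indicator (λ _ → 1) a)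

      K-square : SecondDifference≤ 13 (K true true) (K true false) (K false true) (K false false)
      K-square rewrite K11 | K10 | K01 | K00 = edgeFormula-square m d x y x≤1 ∑x≡2

  cosmoEdges-square : ∀ {n} (X : Config n) {i j k l} → i <ᶠ j → k <ᶠ l →
    let K : Bool → Bool → ℕ
        K b₁ b₂ = cosmoEdges (arcs (set (set X i j b₁) k l b₂))
    in SecondDifference≤ 13 (K true true) (K true false) (K false true) (K false false)
  cosmoEdges-square X {i} {j} {k} {l} i<j k<l with (i , j) ≟ₐ (k , l)
  ... | no e≢f   = Square.K-square X i<j k<l e≢f
  ... | yes refl rewrite cosmoEdges-cong (set-overwrite X i j true true false)
                       | cosmoEdges-cong (set-overwrite X i j true false false) =
    square (swap K₀₁ K₀₀) (swap K₀₀ K₀₁)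
    where
    K₀₁ K₀₀ : ℕ
    K₀₁ = cosmoEdges (arcs (set (set X i j false) i j true))
    K₀₀ = cosmoEdges (arcs (set (set X i j false) i j false))
    swap : ∀ p q → p + q ≤ q + p + 13
    swap p q = ℕ.≤-trans (ℕ.≤-reflexive (ℕ.+-comm p q)) (ℕ.m≤m+n (q + p) 13)

open import Defs
open EdgeFormula using (F1⇒≡cosmoEdges)
open SecondDifference using (SecondDifference≤-resp; SecondDifference≤⇒∣∣≤; cosmoEdges-square)
open import Relation.Binary.PropositionalEquality using (sym)
open import Data.Nat using (ℕ; _≤_; _<_; s≤s; z≤n)
open import Data.Fin using (Fin)
open import Data.Bool using (true; false)
open import Data.Product using (Σ; _×_; _,_)
open import Data.Integer using (+_; _-_; ∣_∣)
open import Data.Integer using () renaming (_+_ to _+ℤ_)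

-- D_f D_e K = p(1−p)(K⁺⁺ − K⁺⁻ − K⁻⁺ + K⁻⁻) with K^{±±} = f₁ for (X_e , X_f) = (±1 , ±1).
lemma3p7 : Σ ℕ λ C → 0 < C ×
    (∀ n (X : Config n) (i j k l : Fin n) → i Data.Fin.< j → k Data.Fin.< l →
      ∀ a b c d →
      F1 (set (set X i j true) k l true) a →
      F1 (set (set X i j true) k l false) b →
      F1 (set (set X i j false) k l true) c →
      F1 (set (set X i j false) k l false) d →
      ∣ (((+ a) - (+ b)) - (+ c)) +ℤ (+ d) ∣ ≤ C)
lemma3p7 = 13 , s≤s z≤n , λ n X i j k l i<j k<l a b c d f₁a f₁b f₁c f₁d →
  SecondDifference≤⇒∣∣≤ (SecondDifference≤-resp (sym (F1⇒≡cosmoEdges _ f₁a)) (sym (F1⇒≡cosmoEdges _ f₁b))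
    (sym (F1⇒≡cosmoEdges _ f₁c)) (sym (F1⇒≡cosmoEdges _ f₁d)) (cosmoEdges-square X i<j k<l))
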